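{- Let $T$ be a rooted binary phylogenetic tree on a taxon set $X'$ and let $F'$ be a forest consisting of three components $A,B,C$ (rooted binary phylogenetic trees whose leaf sets partition $X'$; we identify each component with its leaf set). Suppose: $T|A=F'|A$ and $T|C=F'|C$ but $T|B\neq F'|B$; $T[C]$ is vertex-disjoint from $T[A]$ and $T[B]$; and $T[A]$ and $T[B]$ share exactly one edge $e$ of $T$. Let $B_1,B_2$ be the bipartition of $B$ induced by $e$ (taxa of $B$ on the same side of $e$ in $T[B]$). Then among the agreement forests reachable from $(T,F')$ with the minimum number of components, there is one in which no component contains taxa from both $B_1$ and $B_2$ (i.e. cutting $B$ into $B_1$ and $B_2$ with a single cut is safe).
   Context: A rooted binary phylogenetic tree is a directed tree whose leaves are bijectively labelled by taxa, with a root of indegree 0 and outdegree 2 and all other internal nodes of indegree 1 and outdegree 2. For a set $S$ of taxa, $T[S]$ is the minimal subtree of $T$ connecting $S$, and $T|S$ is obtained from $T[S]$ by suppressing nodes of indegree 1 and outdegree 1; for $S$ contained in the leaf set of a component $D$ of $F'$, $F'[S]=D[S]$ and $F'|S=D|S$; equality of restricted trees means isomorphism that is the identity on the taxa. An agreement forest reachable from $(T,F')$ is a partition $P$ of $X'$ refining the partition $\{A,B,C\}$ such that $T|S=F'|S$ for each block $S$, and for distinct blocks $S,S'$ the subtrees $T[S],T[S']$ are vertex-disjoint and $F'[S],F'[S']$ are vertex-disjoint. -}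

module Defs where

open import Data.Nat using (ℕ; _≤_)
open import Data.Nat.Properties using (_≟_)
open import Data.Bool using (Bool; true; false; if_then_else_)
open import Data.List using (List; []; _∷_; _++_; [_]; length; lookup; concat)
open import Data.List.Membership.Propositional using (_∈_)
open import Data.List.Membership.DecPropositional _≟_ using (_∈?_)
open import Data.List.Relation.Binary.Subset.Propositional using (_⊆_)
open import Data.List.Relation.Binary.Permutation.Propositional using (_↭_)
open import Data.List.Relation.Unary.All using (All)
open import Data.List.Relation.Unary.Unique.Propositional using (Unique)
open import Data.Maybe using (Maybe; just; nothing)
open import Data.Product using (Σ; ∃; _×_; _,_)
open import Data.Sum using (_⊎_)
open import Data.Fin using (Fin)
open import Data.Empty using (⊥)
open import Relation.Nullary using (¬_; does)
open import Relation.Binary.PropositionalEquality using (_≡_; _≢_)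

-- Bijectivity of the labelling = the leaf labels are pairwise distinct.

data Tree : Set where
  leaf : ℕ → Tree
  node : Tree → Tree → Tree

leaves : Tree → List ℕ
leaves (leaf x)   = x ∷ []
leaves (node l r) = leaves l ++ leaves r

Phylo : Tree → Set
Phylo t = Unique (leaves t)

-- Isomorphism of trees that is the identity on the taxa
-- (children of a node are unordered).
data _≅_ : Tree → Tree → Set where
  leaf≅ : ∀ x → leaf x ≅ leaf x
  node≅ : ∀ {a b c d} → a ≅ c → b ≅ d → node a b ≅ node c d
  swap≅ : ∀ {a b c d} → a ≅ d → b ≅ c → node a b ≅ node c d

data _≃_ : Maybe Tree → Maybe Tree → Set where
  nothing≃ : nothing ≃ nothing
  just≃    : ∀ {s t} → s ≅ t → just s ≃ just t

-- Restriction t|S : take the minimal subtree connecting S and suppress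
-- the resulting indegree-1 outdegree-1 nodes (nothing if S misses t).

restrict : List ℕ → Tree → Maybe Tree
restrict S (leaf x) = if does (x ∈? S) then just (leaf x) else nothing
restrict S (node l r) = combine (restrict S l) (restrict S r)
  where
  combine : Maybe Tree → Maybe Tree → Maybe Tree
  combine (just a) (just b) = just (node a b)
  combine (just a) nothing  = just a
  combine nothing  (just b) = just b
  combine nothing  nothing  = nothing

-- Vertices of a tree are addressed by positions (paths from the root;
-- false = left child, true = right child).

Pos : Set
Pos = List Bool

subtree : Tree → Pos → Maybe Tree
subtree t [] = just t
subtree (leaf x) (_ ∷ _) = nothing
subtree (node l r) (false ∷ p) = subtree l p
subtree (node l r) (true ∷ p) = subtree r p

LeafAt : Tree → Pos → ℕ → Set
LeafAt t p x = subtree t p ≡ just (leaf x)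

-- p is a prefix of q  (p is an ancestor-or-equal of q)
_⊑_ : Pos → Pos → Set
p ⊑ q = ∃ λ s → p ++ s ≡ q

-- longest common prefix  (position of the lowest common ancestor)
lcp : Pos → Pos → Pos
lcp (false ∷ p) (false ∷ q) = false ∷ lcp p q
lcp (true ∷ p)  (true ∷ q)  = true ∷ lcp p q
lcp _ _ = []

-- r lies on the (unique) path in the tree between vertices p and q
OnPath : Pos → Pos → Pos → Set
OnPath p q r = (r ⊑ p ⊎ r ⊑ q) × (lcp p q ⊑ r)

-- r is a vertex of t[S], the minimal subtree of t connecting S
-- (= union of the paths between pairs of leaves labelled in S)
InSpan : Tree → List ℕ → Pos → Set
InSpan t S r = ∃ λ x → ∃ λ y → ∃ λ p → ∃ λ q →
  x ∈ S × y ∈ S × LeafAt t p x × LeafAt t q y × OnPath p q r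

SpanDisjoint : Tree → List ℕ → List ℕ → Set
SpanDisjoint t S S' = ∀ r → InSpan t S r → InSpan t S' r → ⊥

-- An edge of a tree is given by (p , b): it joins p to its child p ++ [ b ].
Edge : Set
Edge = Pos × Bool

EdgeInSpan : Tree → List ℕ → Edge → Set
EdgeInSpan t S (p , b) = InSpan t S p × InSpan t S (p ++ [ b ])

Below : Tree → Edge → ℕ → Set
Below t (p , b) x = ∃ λ q → LeafAt t q x × (p ++ [ b ]) ⊑ q

-- Agreement forests reachable from (T, F') where F' has the three
-- components tA, tB, tC (with leaf sets A, B, C).
-- A partition of X' = leaves T is a list of nonempty blocks whose
-- concatenation is a permutation of X'; its number of components is
-- its length.

record ReachableAF (T tA tB tC : Tree) (P : List (List ℕ)) : Set where
  field
    nonempty  : All (λ S → S ≢ []) P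
    partition : concat P ↭ leaves T
    refines   : All (λ S → S ⊆ leaves tA ⊎ S ⊆ leaves tB ⊎ S ⊆ leaves tC) P
    -- T|S = F'|S, where F'|S = D|S for the component D containing S
    agree     : ∀ (i : Fin (length P)) (D : Tree) →
                (D ≡ tA ⊎ D ≡ tB ⊎ D ≡ tC) → lookup P i ⊆ leaves D →
                restrict (lookup P i) T ≃ restrict (lookup P i) D
    disjT     : ∀ (i j : Fin (length P)) → i ≢ j →
                SpanDisjoint T (lookup P i) (lookup P j)
    -- blocks in different components of F' are trivially disjoint in F';
    -- blocks in the same component D must have disjoint D[S], D[S']
    disjF     : ∀ (i j : Fin (length P)) → i ≢ j → (D : Tree) →
                (D ≡ tA ⊎ D ≡ tB ⊎ D ≡ tC) →
                lookup P i ⊆ leaves D → lookup P j ⊆ leaves D →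
                SpanDisjoint D (lookup P i) (lookup P j)

MinReachableAF : (T tA tB tC : Tree) (P : List (List ℕ)) → Set
MinReachableAF T tA tB tC P =
  ReachableAF T tA tB tC P ×
  (∀ Q → ReachableAF T tA tB tC Q → length P ≤ length Q)

{-# OPTIONS --safe #-}
module Submission where

-- Start from a reachable agreement forest of minimum size (one exists by a finite
-- search). If a block S mixes taxa of B from both sides of e, then e lies in T[S], so
-- no other span contains an endpoint u, v of e. Among the A-blocks with a taxon below
-- e, take K₁ with a span vertex h₁ closest to u; among those with a taxon above e,
-- take K₂ with such a vertex h₂. Replace S, K₁, K₂ by the two halves of S and by
-- K₁ ∪ K₂: the number of blocks is unchanged, T[K₁ ∪ K₂] only adds the path from h₁
-- through u to h₂, which the choice of h₁ and h₂ keeps clear of all other blocks, and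
-- the conditions in F′ follow from those in T because T|A = F′|A. No block of the
-- new forest crosses e: the remaining blocks avoid u and v.

open import Defs
open import Data.Nat using (ℕ)
open import Data.Bool using (Bool)
open import Data.List using (List; _++_)
open import Data.List.Membership.Propositional using (_∈_)
open import Data.List.Relation.Binary.Permutation.Propositional using (_↭_)
open import Data.List.Relation.Unary.All using (All)
open import Data.Product using (Σ; ∃; _×_; _,_)
open import Data.Empty using (⊥)
open import Relation.Nullary using (¬_)
open import Relation.Binary.PropositionalEquality using (_≡_)
open import Data.Nat using (_≤_)
open import Data.List using (length)
open import Relation.Binary.PropositionalEquality using (sym; subst)

module Paths where
  open import Data.Nat using (ℕ; suc; _+_; _*_; _∸_; _≤_; _<_; z≤n; s≤s)
  open import Data.Nat.Properties
    using (<-irrefl; m≤m+n; m<m+n; +-monoˡ-<; m+n∸m≡n; +-assoc; +-comm)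
  open import Data.Nat.Solver using (module +-*-Solver)
  open import Data.Bool using (Bool; true; false; not)
  open import Data.Bool.Properties using (¬-not) renaming (_≟_ to _≟ᵇ_)
  open import Data.List using ([]; _∷_; _++_; [_]; length; initLast; _∷ʳ′_)
  open import Data.List.Properties using (++-assoc; ++-identityʳ; length-++; ≡-dec)
  open import Data.Product using (∃; _×_; _,_; proj₁; proj₂)
  open import Data.Sum as Sum using (_⊎_; inj₁; inj₂)
  open import Function using (_∘_)
  open import Data.Empty using (⊥-elim)
  open import Relation.Nullary using (¬_; Dec; yes; no)
  open import Relation.Binary.PropositionalEquality hiding ([_])

  _≟ₚ_ : ∀ (p q : Pos) → Dec (p ≡ q)
  _≟ₚ_ = ≡-dec _≟ᵇ_

  ⊑-refl : ∀ {p} → p ⊑ p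
  ⊑-refl {p} = [] , ++-identityʳ p

  []⊑ : ∀ {p} → [] ⊑ p
  []⊑ {p} = p , refl

  ⊑-++ : ∀ p s → p ⊑ (p ++ s)
  ⊑-++ p s = s , refl

  ⊑-trans : ∀ {p q r} → p ⊑ q → q ⊑ r → p ⊑ r
  ⊑-trans {p} (s , refl) (t , refl) = s ++ t , sym (++-assoc p s t)

  ⊑-∷⁺ : ∀ {a p q} → p ⊑ q → (a ∷ p) ⊑ (a ∷ q)
  ⊑-∷⁺ (s , refl) = s , refl

  ⊑-∷⁻ : ∀ {a b p q} → (a ∷ p) ⊑ (b ∷ q) → a ≡ b × p ⊑ q
  ⊑-∷⁻ (s , refl) = refl , (s , refl)

  ∷⋢[] : ∀ {a p} → ¬ ((a ∷ p) ⊑ [])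
  ∷⋢[] (s , ())

  ⊑[]⇒≡[] : ∀ {p} → p ⊑ [] → p ≡ []
  ⊑[]⇒≡[] {[]} _ = refl
  ⊑[]⇒≡[] {_ ∷ _} x = ⊥-elim (∷⋢[] x)

  ⊑-antisym : ∀ {p q} → p ⊑ q → q ⊑ p → p ≡ q
  ⊑-antisym {[]} {[]} _ _ = refl
  ⊑-antisym {[]} {_ ∷ _} _ x = ⊥-elim (∷⋢[] x)
  ⊑-antisym {_ ∷ _} {[]} x _ = ⊥-elim (∷⋢[] x)
  ⊑-antisym {a ∷ p} {b ∷ q} x y with ⊑-∷⁻ x | ⊑-∷⁻ y
  ... | refl , x′ | _ , y′ = cong (a ∷_) (⊑-antisym x′ y′)

  ⊑-length : ∀ {p q} → p ⊑ q → length p ≤ length q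
  ⊑-length {p} (s , refl) = subst (length p ≤_) (sym (length-++ p)) (m≤m+n _ _)

  _⊑?_ : ∀ p q → Dec (p ⊑ q)
  [] ⊑? q = yes []⊑
  (a ∷ p) ⊑? [] = no ∷⋢[]
  (a ∷ p) ⊑? (b ∷ q) with a ≟ᵇ b | p ⊑? q
  ... | yes refl | yes x = yes (⊑-∷⁺ x)
  ... | yes refl | no ¬x = no (λ z → ¬x (proj₂ (⊑-∷⁻ z)))
  ... | no a≢b | _ = no (λ z → a≢b (proj₁ (⊑-∷⁻ z)))

  ⊑-comparable : ∀ {p q r} → p ⊑ r → q ⊑ r → p ⊑ q ⊎ q ⊑ p
  ⊑-comparable {[]} _ _ = inj₁ []⊑
  ⊑-comparable {_ ∷ _} {[]} _ _ = inj₂ []⊑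
  ⊑-comparable {_ ∷ _} {_ ∷ _} {[]} x _ = ⊥-elim (∷⋢[] x)
  ⊑-comparable {_ ∷ _} {_ ∷ _} {_ ∷ _} x y with ⊑-∷⁻ x | ⊑-∷⁻ y
  ... | refl , x′ | refl , y′ with ⊑-comparable x′ y′
  ... | inj₁ z = inj₁ (⊑-∷⁺ z)
  ... | inj₂ z = inj₂ (⊑-∷⁺ z)

  lcp-⊑ˡ : ∀ p q → lcp p q ⊑ p
  lcp-⊑ˡ (false ∷ p) (false ∷ q) = ⊑-∷⁺ (lcp-⊑ˡ p q)
  lcp-⊑ˡ (true ∷ p) (true ∷ q) = ⊑-∷⁺ (lcp-⊑ˡ p q)
  lcp-⊑ˡ [] q = []⊑
  lcp-⊑ˡ (false ∷ p) [] = []⊑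
  lcp-⊑ˡ (false ∷ p) (true ∷ q) = []⊑
  lcp-⊑ˡ (true ∷ p) [] = []⊑
  lcp-⊑ˡ (true ∷ p) (false ∷ q) = []⊑

  lcp-comm : ∀ p q → lcp p q ≡ lcp q p
  lcp-comm (false ∷ p) (false ∷ q) = cong (false ∷_) (lcp-comm p q)
  lcp-comm (true ∷ p) (true ∷ q) = cong (true ∷_) (lcp-comm p q)
  lcp-comm [] [] = refl
  lcp-comm [] (false ∷ _) = refl
  lcp-comm [] (true ∷ _) = refl
  lcp-comm (false ∷ p) [] = refl
  lcp-comm (false ∷ p) (true ∷ q) = refl
  lcp-comm (true ∷ p) [] = refl
  lcp-comm (true ∷ p) (false ∷ q) = refl

  lcp-⊑ʳ : ∀ p q → lcp p q ⊑ q
  lcp-⊑ʳ p q = subst (_⊑ q) (lcp-comm q p) (lcp-⊑ˡ q p)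

  ⊑-lcp : ∀ {r p q} → r ⊑ p → r ⊑ q → r ⊑ lcp p q
  ⊑-lcp {[]} _ _ = []⊑
  ⊑-lcp {_ ∷ _} {[]} x _ = ⊥-elim (∷⋢[] x)
  ⊑-lcp {_ ∷ _} {_ ∷ _} {[]} _ y = ⊥-elim (∷⋢[] y)
  ⊑-lcp {false ∷ r} {_ ∷ _} {_ ∷ _} x y with ⊑-∷⁻ x | ⊑-∷⁻ y
  ... | refl , x′ | refl , y′ = ⊑-∷⁺ (⊑-lcp x′ y′)
  ⊑-lcp {true ∷ r} {_ ∷ _} {_ ∷ _} x y with ⊑-∷⁻ x | ⊑-∷⁻ y
  ... | refl , x′ | refl , y′ = ⊑-∷⁺ (⊑-lcp x′ y′)

  lcp-idem : ∀ p → lcp p p ≡ p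
  lcp-idem p = ⊑-antisym (lcp-⊑ˡ p p) (⊑-lcp ⊑-refl ⊑-refl)

  ⊑⇒lcp≡ : ∀ {r u} → r ⊑ u → lcp u r ≡ r
  ⊑⇒lcp≡ r⊑u = ⊑-antisym (lcp-⊑ʳ _ _) (⊑-lcp r⊑u ⊑-refl)

  ⊑-step : ∀ {r s} → r ⊑ s → r ≢ s → ∃ λ c → (r ++ [ c ]) ⊑ s
  ⊑-step {[]} {[]} _ r≢s = ⊥-elim (r≢s refl)
  ⊑-step {[]} {c ∷ s} _ _ = c , ⊑-∷⁺ []⊑
  ⊑-step {_ ∷ _} {[]} x _ = ⊥-elim (∷⋢[] x)
  ⊑-step {a ∷ r} {_ ∷ _} x r≢s with ⊑-∷⁻ x
  ... | refl , x′ with ⊑-step x′ (λ e → r≢s (cong (a ∷_) e))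
  ... | c , y = c , ⊑-∷⁺ y

  step⊑⇒⊑ : ∀ {r c s} → (r ++ [ c ]) ⊑ s → r ⊑ s
  step⊑⇒⊑ {r} {c} = ⊑-trans (⊑-++ r [ c ])

  step⊑-unique : ∀ {r c c′ z} → (r ++ [ c ]) ⊑ z → (r ++ [ c′ ]) ⊑ z → c ≡ c′
  step⊑-unique {[]} {z = []} x _ = ⊥-elim (∷⋢[] x)
  step⊑-unique {[]} {z = _ ∷ _} x y with ⊑-∷⁻ x | ⊑-∷⁻ y
  ... | refl , _ | refl , _ = refl
  step⊑-unique {_ ∷ _} {z = []} x _ = ⊥-elim (∷⋢[] x)
  step⊑-unique {_ ∷ r} {z = _ ∷ _} x y = step⊑-unique {r} (proj₂ (⊑-∷⁻ x)) (proj₂ (⊑-∷⁻ y))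

  length-step : ∀ (r : Pos) c → length (r ++ [ c ]) ≡ suc (length r)
  length-step r c = trans (length-++ r) (+-comm (length r) 1)

  step⋢ : ∀ {r c} → ¬ ((r ++ [ c ]) ⊑ r)
  step⋢ {r} {c} x = <-irrefl refl (subst (_≤ length r) (length-step r c) (⊑-length x))

  ⊑-step⁻ : ∀ {a q c} → a ⊑ (q ++ [ c ]) → a ≢ (q ++ [ c ]) → a ⊑ q
  ⊑-step⁻ {[]} _ _ = []⊑
  ⊑-step⁻ {x ∷ a} {[]} y ne with ⊑-∷⁻ y
  ... | refl , y′ with ⊑[]⇒≡[] y′
  ... | refl = ⊥-elim (ne refl)
  ⊑-step⁻ {x ∷ a} {_ ∷ _} y ne with ⊑-∷⁻ y
  ... | refl , y′ = ⊑-∷⁺ (⊑-step⁻ y′ (λ e → ne (cong (x ∷_) e)))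

  ⊑-step-other : ∀ {r p c} → r ⊑ p → r ≢ p → ¬ ((r ++ [ c ]) ⊑ p) → (r ++ [ not c ]) ⊑ p
  ⊑-step-other {r} {p} {c} r⊑p r≢p rc⋢p with ⊑-step r⊑p r≢p
  ... | c′ , rc′⊑p = subst (λ d → (r ++ [ d ]) ⊑ p) c′≡¬c rc′⊑p
    where
    c′≡¬c : c′ ≡ not c
    c′≡¬c = ¬-not (λ c′≡c → rc⋢p (subst (λ d → (r ++ [ d ]) ⊑ p) c′≡c rc′⊑p))

  step⊑-both⇒lcp⋢ : ∀ {r c p q} → (r ++ [ c ]) ⊑ p → (r ++ [ c ]) ⊑ q → ¬ (lcp p q ⊑ r)
  step⊑-both⇒lcp⋢ rc⊑p rc⊑q l⊑r = step⋢ (⊑-trans (⊑-lcp rc⊑p rc⊑q) l⊑r)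

  ≢[]⇒step : ∀ {r : Pos} → r ≢ [] → ∃ λ (r₀ : Pos) → ∃ λ (c : Bool) → r ≡ r₀ ++ [ c ]
  ≢[]⇒step {r} r≢[] with initLast r
  ... | [] = ⊥-elim (r≢[] refl)
  ... | r₀ ∷ʳ′ c = r₀ , c , refl

  lcp⊑⊎step⊑lcp : ∀ {r a} b → r ⊑ a → lcp a b ⊑ r ⊎ ∃ λ c → (r ++ [ c ]) ⊑ lcp a b
  lcp⊑⊎step⊑lcp {r} {a} b r⊑a with ⊑-comparable (lcp-⊑ˡ a b) r⊑a
  ... | inj₁ l⊑r = inj₁ l⊑r
  ... | inj₂ r⊑l with r ≟ₚ lcp a b
  ...   | yes refl = inj₁ ⊑-refl
  ...   | no r≢l = inj₂ (⊑-step r⊑l r≢l)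

  OnPath-sym : ∀ {p q r} → OnPath p q r → OnPath q p r
  OnPath-sym {p} {q} (inj₁ x , l) = inj₂ x , subst (_⊑ _) (lcp-comm p q) l
  OnPath-sym {p} {q} (inj₂ x , l) = inj₁ x , subst (_⊑ _) (lcp-comm p q) l

  OnPath-refl : ∀ p → OnPath p p p
  OnPath-refl p = inj₁ ⊑-refl , subst (_⊑ p) (sym (lcp-idem p)) ⊑-refl

  OnPath-refl⁻ : ∀ {p r} → OnPath p p r → r ≡ p
  OnPath-refl⁻ {p} (inj₁ x , l) = ⊑-antisym x (subst (_⊑ _) (lcp-idem p) l)
  OnPath-refl⁻ {p} (inj₂ x , l) = ⊑-antisym x (subst (_⊑ _) (lcp-idem p) l)

  OnPath-∷⁺ : ∀ c {p q s} → OnPath p q s → OnPath (c ∷ p) (c ∷ q) (c ∷ s)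
  OnPath-∷⁺ false (s⊑p⊎s⊑q , l⊑s) = Sum.map ⊑-∷⁺ ⊑-∷⁺ s⊑p⊎s⊑q , ⊑-∷⁺ l⊑s
  OnPath-∷⁺ true (s⊑p⊎s⊑q , l⊑s) = Sum.map ⊑-∷⁺ ⊑-∷⁺ s⊑p⊎s⊑q , ⊑-∷⁺ l⊑s

  OnPath-∷⁻ : ∀ c {p q s} → OnPath (c ∷ p) (c ∷ q) (c ∷ s) → OnPath p q s
  OnPath-∷⁻ false (s⊑p⊎s⊑q , l⊑s) = Sum.map (proj₂ ∘ ⊑-∷⁻) (proj₂ ∘ ⊑-∷⁻) s⊑p⊎s⊑q , proj₂ (⊑-∷⁻ l⊑s)
  OnPath-∷⁻ true (s⊑p⊎s⊑q , l⊑s) = Sum.map (proj₂ ∘ ⊑-∷⁻) (proj₂ ∘ ⊑-∷⁻) s⊑p⊎s⊑q , proj₂ (⊑-∷⁻ l⊑s)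

  OnPath-subpath : ∀ {a b h r} → OnPath a b h → OnPath a h r → OnPath a b r
  OnPath-subpath {a} {b} {h} {r} (h⊑a⊎h⊑b , l⊑h) (r⊑a⊎r⊑h , l′⊑r) =
    r⊑a⊎r⊑b r⊑a⊎r⊑h h⊑a⊎h⊑b , ⊑-trans (⊑-lcp (lcp-⊑ˡ a b) l⊑h) l′⊑r
    where
    r⊑a⊎r⊑b : r ⊑ a ⊎ r ⊑ h → h ⊑ a ⊎ h ⊑ b → r ⊑ a ⊎ r ⊑ b
    r⊑a⊎r⊑b (inj₁ r⊑a) _ = inj₁ r⊑a
    r⊑a⊎r⊑b (inj₂ r⊑h) (inj₁ h⊑a) = inj₁ (⊑-trans r⊑h h⊑a)
    r⊑a⊎r⊑b (inj₂ r⊑h) (inj₂ h⊑b) = inj₂ (⊑-trans r⊑h h⊑b)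

  private
    OnPath-viaˡ : ∀ {p q r} z → r ⊑ p → lcp p q ⊑ r → OnPath p z r ⊎ OnPath z q r
    OnPath-viaˡ {p} {q} {r} z r⊑p l⊑r with lcp⊑⊎step⊑lcp z r⊑p
    ... | inj₁ l′⊑r = inj₁ (inj₁ r⊑p , l′⊑r)
    ... | inj₂ (c , rc⊑lpz) with lcp⊑⊎step⊑lcp q (step⊑⇒⊑ (⊑-trans rc⊑lpz (lcp-⊑ʳ p z)))
    ...   | inj₁ l″⊑r = inj₂ (inj₁ (step⊑⇒⊑ (⊑-trans rc⊑lpz (lcp-⊑ʳ p z))) , l″⊑r)
    ...   | inj₂ (c′ , rc′⊑lzq) = ⊥-elim (step⊑-both⇒lcp⋢ (⊑-trans rc⊑lpz (lcp-⊑ˡ p z)) rc⊑q l⊑r)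
      where
      -- both children of r lie below z, so they coincide
      rc⊑q : (r ++ [ c ]) ⊑ q
      rc⊑q = subst (λ d → (r ++ [ d ]) ⊑ q)
        (sym (step⊑-unique {r} (⊑-trans rc⊑lpz (lcp-⊑ʳ p z)) (⊑-trans rc′⊑lzq (lcp-⊑ˡ z q))))
        (⊑-trans rc′⊑lzq (lcp-⊑ʳ z q))

  OnPath-via : ∀ {p q r} z → OnPath p q r → OnPath p z r ⊎ OnPath z q r
  OnPath-via z (inj₁ r⊑p , l⊑r) = OnPath-viaˡ z r⊑p l⊑r
  OnPath-via {p} {q} z (inj₂ r⊑q , l⊑r) with OnPath-viaˡ {q} {p} z r⊑q (subst (_⊑ _) (lcp-comm p q) l⊑r)
  ... | inj₁ o = inj₂ (OnPath-sym o)
  ... | inj₂ o = inj₁ (OnPath-sym o)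

  OnPath-below-step : ∀ {u h r c} → (u ++ [ c ]) ⊑ h → OnPath u h r → r ≢ u → (u ++ [ c ]) ⊑ r
  OnPath-below-step {u} {h} {r} {c} uc⊑h (r⊑u⊎r⊑h , l⊑r) r≢u = below r⊑u⊎r⊑h
    where
    u⊑r : u ⊑ r
    u⊑r = subst (_⊑ r) (trans (lcp-comm u h) (⊑⇒lcp≡ (step⊑⇒⊑ uc⊑h))) l⊑r
    below : r ⊑ u ⊎ r ⊑ h → (u ++ [ c ]) ⊑ r
    below (inj₁ r⊑u) = ⊥-elim (r≢u (⊑-antisym r⊑u u⊑r))
    below (inj₂ r⊑h) with ⊑-step u⊑r (λ u≡r → r≢u (sym u≡r))
    ... | d , ud⊑r = subst (λ d′ → (u ++ [ d′ ]) ⊑ r) (step⊑-unique {u} (⊑-trans ud⊑r r⊑h) uc⊑h) ud⊑r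

  -- The tree distance from u to h shifted by the constant length u, so that the
  -- only subtraction, length u ∸ length (lcp u h), never truncates.
  offsetDist : Pos → Pos → ℕ
  offsetDist u h = length h + 2 * (length u ∸ length (lcp u h))

  private
    split-sum : ∀ l a b c → l + c + 2 * (a + b) ≡ (l + a + 2 * b) + (a + c)
    split-sum = solve 4 (λ l a b c → l :+ c :+ con 2 :* (a :+ b) := (l :+ a :+ con 2 :* b) :+ (a :+ c)) refl
      where open +-*-Solver

    ascending-< : ∀ l a b c → 0 < a + c →
      (l + a) + 2 * ((l + a + b) ∸ (l + a)) < (l + c) + 2 * ((l + a + b) ∸ l)
    ascending-< l a b c 0<a+c
      rewrite m+n∸m≡n (l + a) b | +-assoc l a b | m+n∸m≡n l (a + b) | split-sum l a b c
      = m<m+n (l + a + 2 * b) 0<a+c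

    0<length+length : ∀ {l : Pos} s t → (l ++ s) ≢ (l ++ t) → 0 < length s + length t
    0<length+length [] [] ne = ⊥-elim (ne refl)
    0<length+length (_ ∷ _) _ _ = s≤s z≤n
    0<length+length [] (_ ∷ _) _ = s≤s z≤n

    lcp-along : ∀ {u h r} → lcp u h ⊑ r → r ⊑ h → lcp u r ≡ lcp u h
    lcp-along {u} {h} {r} l⊑r r⊑h =
      ⊑-antisym (⊑-lcp (lcp-⊑ˡ u r) (⊑-trans (lcp-⊑ʳ u r) r⊑h)) (⊑-lcp (lcp-⊑ˡ u h) l⊑r)

  OnPath⇒offsetDist< : ∀ {u h r} → OnPath u h r → r ≢ h → offsetDist u r < offsetDist u h
  OnPath⇒offsetDist< {u} {h} {r} (inj₁ r⊑u , l⊑r) r≢h rewrite ⊑⇒lcp≡ r⊑u =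
    ascending l⊑r r⊑u (lcp-⊑ʳ u h)
    where
    ascending : ∀ {l} → l ⊑ r → r ⊑ u → l ⊑ h →
      length r + 2 * (length u ∸ length r) < length h + 2 * (length u ∸ length l)
    ascending {l} (s₁ , refl) (s₂ , refl) (s₃ , refl)
      rewrite length-++ (l ++ s₁) {s₂} | length-++ l {s₁} | length-++ l {s₃} =
      ascending-< (length l) (length s₁) (length s₂) (length s₃) (0<length+length s₁ s₃ r≢h)
  OnPath⇒offsetDist< {u} {h} {r} (inj₂ r⊑h , l⊑r) r≢h rewrite lcp-along l⊑r r⊑h with ⊑-step r⊑h r≢h
  ... | c , rc⊑h = +-monoˡ-< (2 * (length u ∸ length (lcp u h)))
                     (subst (_≤ length h) (length-step r c) (⊑-length rc⊑h))

module Leaves where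
  open Paths
  open import Data.Bool using (true; false)
  open import Data.List using (List; []; _∷_; _++_)
  open import Data.List.Properties using (++-identityʳ)
  open import Data.List.Membership.Propositional using (_∈_)
  open import Data.List.Membership.Propositional.Properties using (∈-++⁺ˡ; ∈-++⁺ʳ; ∈-++⁻)
  open import Data.List.Relation.Unary.Any using (here; there)
  open import Data.List.Relation.Unary.All as All using ()
  open import Data.List.Relation.Unary.All.Properties using (++⁻ˡ; ++⁻ʳ)
  open import Data.List.Relation.Unary.Unique.Propositional using (Unique; []; _∷_)
  open import Data.Maybe using (just; _>>=_)
  open import Data.Product using (∃; _,_)
  open import Data.Sum using (inj₁; inj₂)
  open import Data.Empty using (⊥; ⊥-elim)
  open import Relation.Binary.PropositionalEquality

  module _ {A : Set} where

    Unique-++⁻ˡ : ∀ {xs ys : List A} → Unique (xs ++ ys) → Unique xs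
    Unique-++⁻ˡ {[]} _ = []
    Unique-++⁻ˡ {x ∷ xs} (x∉ ∷ u) = ++⁻ˡ xs x∉ ∷ Unique-++⁻ˡ u

    Unique-++⁻ʳ : ∀ xs {ys : List A} → Unique (xs ++ ys) → Unique ys
    Unique-++⁻ʳ [] u = u
    Unique-++⁻ʳ (x ∷ xs) (_ ∷ u) = Unique-++⁻ʳ xs u

    Unique-++⇒disjoint : ∀ {xs ys : List A} {x} → Unique (xs ++ ys) → x ∈ xs → x ∈ ys → ⊥
    Unique-++⇒disjoint {_ ∷ xs} (x∉ ∷ _) (here refl) x∈ys = All.lookup (++⁻ʳ xs x∉) x∈ys refl
    Unique-++⇒disjoint (_ ∷ u) (there x∈xs) x∈ys = Unique-++⇒disjoint u x∈xs x∈ys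

  subtree-++ : ∀ t p s → subtree t (p ++ s) ≡ (subtree t p >>= λ t′ → subtree t′ s)
  subtree-++ t [] s = refl
  subtree-++ (leaf x) (_ ∷ p) s = refl
  subtree-++ (node l r) (false ∷ p) s = subtree-++ l p s
  subtree-++ (node l r) (true ∷ p) s = subtree-++ r p s

  LeafAt-maximal : ∀ {t p x q u} → LeafAt t p x → p ⊑ q → subtree t q ≡ just u → q ≡ p
  LeafAt-maximal {t} {p} {x} {u = u} lx (s , refl) eq = below-leaf s
    (trans (cong (_>>= λ t′ → subtree t′ s) (sym lx)) (trans (sym (subtree-++ t p s)) eq))
    where
    below-leaf : ∀ s → subtree (leaf x) s ≡ just u → p ++ s ≡ p
    below-leaf [] _ = ++-identityʳ p
    below-leaf (_ ∷ _) ()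

  LeafAt-functional : ∀ {t p x y} → LeafAt t p x → LeafAt t p y → x ≡ y
  LeafAt-functional a b with trans (sym a) b
  ... | refl = refl

  LeafAt⇒∈ : ∀ {t p x} → LeafAt t p x → x ∈ leaves t
  LeafAt⇒∈ {leaf y} {[]} refl = here refl
  LeafAt⇒∈ {node l r} {false ∷ p} lx = ∈-++⁺ˡ (LeafAt⇒∈ {l} {p} lx)
  LeafAt⇒∈ {node l r} {true ∷ p} lx = ∈-++⁺ʳ (leaves l) (LeafAt⇒∈ {r} {p} lx)

  ∈⇒LeafAt : ∀ {t x} → x ∈ leaves t → ∃ λ p → LeafAt t p x
  ∈⇒LeafAt {leaf y} (here refl) = [] , refl
  ∈⇒LeafAt {node l r} x∈ with ∈-++⁻ (leaves l) x∈
  ... | inj₁ x∈l = let (p , lx) = ∈⇒LeafAt {l} x∈l in false ∷ p , lx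
  ... | inj₂ x∈r = let (p , lx) = ∈⇒LeafAt {r} x∈r in true ∷ p , lx

  LeafAt-injective : ∀ {t p q x} → Phylo t → LeafAt t p x → LeafAt t q x → p ≡ q
  LeafAt-injective {leaf y} {[]} {[]} _ _ _ = refl
  LeafAt-injective {node l r} {false ∷ p} {false ∷ q} u a b =
    cong (false ∷_) (LeafAt-injective (Unique-++⁻ˡ u) a b)
  LeafAt-injective {node l r} {true ∷ p} {true ∷ q} u a b =
    cong (true ∷_) (LeafAt-injective (Unique-++⁻ʳ (leaves l) u) a b)
  LeafAt-injective {node l r} {false ∷ p} {true ∷ q} u a b =
    ⊥-elim (Unique-++⇒disjoint u (LeafAt⇒∈ {l} {p} a) (LeafAt⇒∈ {r} {q} b))
  LeafAt-injective {node l r} {true ∷ p} {false ∷ q} u a b =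
    ⊥-elim (Unique-++⇒disjoint u (LeafAt⇒∈ {l} {q} b) (LeafAt⇒∈ {r} {p} a))

module Spans where
  open Paths
  open Leaves
  open import Data.Nat using (ℕ)
  open import Data.Bool using (true; false)
  open import Data.List using (List; []; _∷_; _++_; [_]; map)
  open import Data.List.Membership.Propositional using (_∈_)
  open import Data.List.Membership.Propositional.Properties using (∈-++⁺ˡ; ∈-++⁺ʳ; ∈-++⁻; ∈-map⁺)
  open import Data.List.Relation.Binary.Subset.Propositional using (_⊆_)
  open import Data.List.Relation.Unary.Any using (here; there)
  open import Data.Maybe using (just; nothing)
  open import Data.Product using (∃; _×_; _,_)
  open import Data.Sum using (_⊎_; inj₁; inj₂)
  open import Data.Empty using (⊥-elim)
  open import Relation.Nullary using (¬_)
  open import Relation.Binary.PropositionalEquality hiding ([_])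

  Above : Tree → List ℕ → Pos → Set
  Above t S r = ∃ λ x → ∃ λ q → x ∈ S × LeafAt t q x × r ⊑ q

  InSpan-mono : ∀ {t S S′ r} → S ⊆ S′ → InSpan t S r → InSpan t S′ r
  InSpan-mono S⊆S′ (x , y , p , q , x∈ , y∈ , lx , ly , o) = x , y , p , q , S⊆S′ x∈ , S⊆S′ y∈ , lx , ly , o

  InSpan-leaf : ∀ {t S x p} → x ∈ S → LeafAt t p x → InSpan t S p
  InSpan-leaf {p = p} x∈ lx = _ , _ , p , p , x∈ , x∈ , lx , lx , OnPath-refl p

  InSpan⇒Above : ∀ {t S r} → InSpan t S r → Above t S r
  InSpan⇒Above (x , _ , p , _ , x∈ , _ , lx , _ , (inj₁ r⊑p , _)) = x , p , x∈ , lx , r⊑p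
  InSpan⇒Above (_ , y , _ , q , _ , y∈ , _ , ly , (inj₂ r⊑q , _)) = y , q , y∈ , ly , r⊑q

  InSpan-convex : ∀ {t S a b r} → InSpan t S a → InSpan t S b → OnPath a b r → InSpan t S r
  InSpan-convex (x₁ , y₁ , p₁ , q₁ , x₁∈ , y₁∈ , lx₁ , ly₁ , o₁)
                (x₂ , y₂ , p₂ , q₂ , x₂∈ , y₂∈ , lx₂ , ly₂ , o₂) o
    with OnPath-via p₁ o
  ... | inj₁ o′ = x₁ , y₁ , p₁ , q₁ , x₁∈ , y₁∈ , lx₁ , ly₁ , OnPath-subpath o₁ (OnPath-sym o′)
  ... | inj₂ o′ with OnPath-via p₂ o′
  ...   | inj₁ o″ = x₁ , x₂ , p₁ , p₂ , x₁∈ , x₂∈ , lx₁ , lx₂ , o″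
  ...   | inj₂ o″ = x₂ , y₂ , p₂ , q₂ , x₂∈ , y₂∈ , lx₂ , ly₂ , OnPath-subpath o₂ o″

  InSpan-below : ∀ {t S r w} → (∀ {x q} → x ∈ S → LeafAt t q x → w ⊑ q) → InSpan t S r → w ⊑ r
  InSpan-below below (_ , _ , _ , _ , x∈ , y∈ , lx , ly , (_ , l⊑r)) =
    ⊑-trans (⊑-lcp (below x∈ lx) (below y∈ ly)) l⊑r

  EdgeInSpan-separating : ∀ {t S x y px py q c} →
    x ∈ S → LeafAt t px x → (q ++ [ c ]) ⊑ px →
    y ∈ S → LeafAt t py y → ¬ ((q ++ [ c ]) ⊑ py) → EdgeInSpan t S (q , c)
  EdgeInSpan-separating {x = x} {y} {px} {py} {q} {c} x∈ lx qc⊑px y∈ ly qc⋢py =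
    (x , y , px , py , x∈ , y∈ , lx , ly , inj₁ (step⊑⇒⊑ qc⊑px) , l⊑q) ,
    (x , y , px , py , x∈ , y∈ , lx , ly , inj₁ qc⊑px , l⊑qc)
    where
    l⊑qc : lcp px py ⊑ (q ++ [ c ])
    l⊑qc with ⊑-comparable (lcp-⊑ˡ px py) qc⊑px
    ... | inj₁ l⊑qc = l⊑qc
    ... | inj₂ qc⊑l = ⊥-elim (qc⋢py (⊑-trans qc⊑l (lcp-⊑ʳ px py)))
    l⊑q : lcp px py ⊑ q
    l⊑q = ⊑-step⁻ l⊑qc (λ l≡qc → qc⋢py (subst (_⊑ py) l≡qc (lcp-⊑ʳ px py)))

  InSpan-singleton : ∀ {t x r} → Phylo t → InSpan t (x ∷ []) r → LeafAt t r x
  InSpan-singleton {t} ph (_ , _ , p , q , here refl , here refl , lx , ly , o)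
    with LeafAt-injective {t} {p} {q} ph lx ly
  ... | refl with OnPath-refl⁻ {p} o
  ... | refl = lx

  private
    InSpan-across : ∀ {t S S′ h h′ r x y p q} → InSpan t S h → InSpan t S′ h′ →
      x ∈ S → LeafAt t p x → y ∈ S′ → LeafAt t q y → OnPath p q r →
      InSpan t S r ⊎ InSpan t S′ r ⊎ OnPath h h′ r
    InSpan-across {t} {h = h} {h′} h∈ h′∈ x∈S lx y∈S′ ly o with OnPath-via h o
    ... | inj₁ o′ = inj₁ (InSpan-convex (InSpan-leaf {t} x∈S lx) h∈ o′)
    ... | inj₂ o′ with OnPath-via h′ o′
    ...   | inj₁ o″ = inj₂ (inj₂ o″)
    ...   | inj₂ o″ = inj₂ (inj₁ (InSpan-convex h′∈ (InSpan-leaf {t} y∈S′ ly) o″))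

  InSpan-++ : ∀ {t S S′ h h′ r} → InSpan t S h → InSpan t S′ h′ → InSpan t (S ++ S′) r →
    InSpan t S r ⊎ InSpan t S′ r ⊎ OnPath h h′ r
  InSpan-++ {S = S} h∈ h′∈ (x , y , p , q , x∈ , y∈ , lx , ly , o) with ∈-++⁻ S x∈ | ∈-++⁻ S y∈
  ... | inj₁ x∈S | inj₁ y∈S = inj₁ (x , y , p , q , x∈S , y∈S , lx , ly , o)
  ... | inj₂ x∈S′ | inj₂ y∈S′ = inj₂ (inj₁ (x , y , p , q , x∈S′ , y∈S′ , lx , ly , o))
  ... | inj₁ x∈S | inj₂ y∈S′ = InSpan-across h∈ h′∈ x∈S lx y∈S′ ly o
  ... | inj₂ x∈S′ | inj₁ y∈S = InSpan-across h∈ h′∈ y∈S ly x∈S′ lx (OnPath-sym o)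

  positions : Tree → List Pos
  positions (leaf x) = [] ∷ []
  positions (node l r) = [] ∷ (map (false ∷_) (positions l) ++ map (true ∷_) (positions r))

  subtree≡just⇒∈positions : ∀ t p {s} → subtree t p ≡ just s → p ∈ positions t
  subtree≡just⇒∈positions (leaf x) [] _ = here refl
  subtree≡just⇒∈positions (node l r) [] _ = here refl
  subtree≡just⇒∈positions (node l r) (false ∷ p) e =
    there (∈-++⁺ˡ (∈-map⁺ (false ∷_) (subtree≡just⇒∈positions l p e)))
  subtree≡just⇒∈positions (node l r) (true ∷ p) e =
    there (∈-++⁺ʳ (map (false ∷_) (positions l)) (∈-map⁺ (true ∷_) (subtree≡just⇒∈positions r p e)))

  InSpan⇒∈positions : ∀ {t S r} → InSpan t S r → r ∈ positions t
  InSpan⇒∈positions {t} {S} {r} r∈ with InSpan⇒Above r∈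
  ... | x , q , _ , lx , (s , refl) with subtree t r in eq | subtree-++ t r s
  ...   | just _ | _ = subtree≡just⇒∈positions t r eq
  ...   | nothing | eq′ with trans (sym lx) eq′
  ...     | ()

module Restriction where
  open Leaves
  open import Data.Nat using (ℕ)
  open import Data.Nat.Properties using (_≟_)
  open import Data.Bool using (Bool; true; false)
  open import Data.List using (List; []; _∷_; [_])
  open import Data.List.Membership.Propositional using (_∈_; _∉_)
  open import Data.List.Membership.DecPropositional _≟_ using (_∈?_)
  open import Data.List.Membership.Propositional.Properties using (∈-++⁺ˡ; ∈-++⁺ʳ; ∈-++⁻)
  open import Data.List.Relation.Binary.Subset.Propositional using (_⊆_)
  open import Data.List.Relation.Unary.Any using (here)
  open import Data.Maybe using (Maybe; just; nothing; _>>=_)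
  open import Data.Sum using (inj₁; inj₂)
  open import Relation.Nullary using (Dec; yes; no; does)
  open import Relation.Nullary.Decidable using (dec-true; dec-false)
  open import Relation.Binary.PropositionalEquality hiding ([_])

  _∈ᵇ_ : ℕ → List ℕ → Bool
  x ∈ᵇ S = does (x ∈? S)

  ∈⇒∈ᵇ : ∀ {x S} → x ∈ S → x ∈ᵇ S ≡ true
  ∈⇒∈ᵇ {x} {S} = dec-true (x ∈? S)

  ∉⇒∈ᵇ : ∀ {x S} → x ∉ S → x ∈ᵇ S ≡ false
  ∉⇒∈ᵇ {x} {S} = dec-false (x ∈? S)

  ∈ᵇ⇒∈ : ∀ {x S} → x ∈ᵇ S ≡ true → x ∈ S
  ∈ᵇ⇒∈ {x} {S} eq with x ∈? S
  ... | yes x∈S = x∈S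

  ∈ᵇ-cong : ∀ {x S S′} → (x ∈ S → x ∈ S′) → (x ∈ S′ → x ∈ S) → x ∈ᵇ S ≡ x ∈ᵇ S′
  ∈ᵇ-cong {x} {S} {S′} to from with x ∈? S′
  ... | yes x∈S′ = ∈⇒∈ᵇ (from x∈S′)
  ... | no x∉S′ = ∉⇒∈ᵇ (λ x∈S → x∉S′ (to x∈S))

  combine : Maybe Tree → Maybe Tree → Maybe Tree
  combine (just a) (just b) = just (node a b)
  combine (just a) nothing  = just a
  combine nothing  (just b) = just b
  combine nothing  nothing  = nothing

  restrict-node : ∀ S l r → restrict S (node l r) ≡ combine (restrict S l) (restrict S r)
  restrict-node S l r with restrict S l | restrict S r
  ... | just a | just b = refl
  ... | just a | nothing = refl
  ... | nothing | just b = refl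
  ... | nothing | nothing = refl

  restrict-cong : ∀ {S S′} → S ⊆ S′ → S′ ⊆ S → ∀ t → restrict S t ≡ restrict S′ t
  restrict-cong to from (leaf x) rewrite ∈ᵇ-cong {x} to from = refl
  restrict-cong {S} {S′} to from (node l r)
    rewrite restrict-node S l r | restrict-node S′ l r | restrict-cong to from l | restrict-cong to from r = refl

  restrict-combine : ∀ S a b → (combine a b >>= restrict S) ≡ combine (a >>= restrict S) (b >>= restrict S)
  restrict-combine S (just a) (just b) = restrict-node S a b
  restrict-combine S (just a) nothing with restrict S a
  ... | just _ = refl
  ... | nothing = refl
  restrict-combine S nothing (just b) with restrict S b
  ... | just _ = refl
  ... | nothing = refl
  restrict-combine S nothing nothing = refl

  restrict-restrict : ∀ {S L} → S ⊆ L → ∀ t → restrict S t ≡ (restrict L t >>= restrict S)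
  restrict-restrict {S} {L} S⊆L (leaf x) with x ∈? L
  ... | yes _ = refl
  ... | no x∉L rewrite ∉⇒∈ᵇ {x} {S} (λ x∈S → x∉L (S⊆L x∈S)) = refl
  restrict-restrict {S} {L} S⊆L (node l r)
    rewrite restrict-node S l r | restrict-node L l r | restrict-combine S (restrict L l) (restrict L r)
          | restrict-restrict S⊆L l | restrict-restrict S⊆L r = refl

  restrict-disjoint : ∀ {S} t → (∀ {x} → x ∈ leaves t → x ∉ S) → restrict S t ≡ nothing
  restrict-disjoint {S} (leaf x) disj rewrite ∉⇒∈ᵇ {x} {S} (disj (here refl)) = refl
  restrict-disjoint {S} (node l r) disj
    rewrite restrict-node S l r | restrict-disjoint l (λ x∈ → disj (∈-++⁺ˡ x∈))
          | restrict-disjoint r (λ x∈ → disj (∈-++⁺ʳ (leaves l) x∈)) = refl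

  restrict-singleton : ∀ {x} t → Phylo t → x ∈ leaves t → restrict [ x ] t ≡ just (leaf x)
  restrict-singleton {x} (leaf _) _ (here refl) rewrite ∈⇒∈ᵇ {x} {[ x ]} (here refl) = refl
  restrict-singleton {x} (node l r) u x∈ rewrite restrict-node [ x ] l r with ∈-++⁻ (leaves l) x∈
  ... | inj₁ x∈l rewrite restrict-singleton l (Unique-++⁻ˡ u) x∈l
                       | restrict-disjoint {[ x ]} r (λ { y∈r (here refl) → Unique-++⇒disjoint u x∈l y∈r }) = refl
  ... | inj₂ x∈r rewrite restrict-singleton r (Unique-++⁻ʳ (leaves l) u) x∈r
                       | restrict-disjoint {[ x ]} l (λ { y∈l (here refl) → Unique-++⇒disjoint u y∈l x∈r }) = refl

  ≅-refl : ∀ {t} → t ≅ t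
  ≅-refl {leaf x} = leaf≅ x
  ≅-refl {node l r} = node≅ ≅-refl ≅-refl

  ≃-refl : ∀ {m} → m ≃ m
  ≃-refl {nothing} = nothing≃
  ≃-refl {just x} = just≃ ≅-refl

  ≡⇒≃ : ∀ {m n} → m ≡ n → m ≃ n
  ≡⇒≃ refl = ≃-refl

  combine-≃ : ∀ {a b c d} → a ≃ c → b ≃ d → combine a b ≃ combine c d
  combine-≃ (just≃ x) (just≃ y) = just≃ (node≅ x y)
  combine-≃ (just≃ x) nothing≃ = just≃ x
  combine-≃ nothing≃ (just≃ y) = just≃ y
  combine-≃ nothing≃ nothing≃ = nothing≃

  combine-≃-swap : ∀ {a b c d} → a ≃ d → b ≃ c → combine a b ≃ combine c d
  combine-≃-swap (just≃ x) (just≃ y) = just≃ (swap≅ x y)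
  combine-≃-swap (just≃ x) nothing≃ = just≃ x
  combine-≃-swap nothing≃ (just≃ y) = just≃ y
  combine-≃-swap nothing≃ nothing≃ = nothing≃

  restrict-≅ : ∀ S {s t} → s ≅ t → restrict S s ≃ restrict S t
  restrict-≅ S (leaf≅ x) = ≃-refl
  restrict-≅ S (node≅ {a} {b} {c} {d} x y)
    rewrite restrict-node S a b | restrict-node S c d = combine-≃ (restrict-≅ S x) (restrict-≅ S y)
  restrict-≅ S (swap≅ {a} {b} {c} {d} x y)
    rewrite restrict-node S a b | restrict-node S c d = combine-≃-swap (restrict-≅ S x) (restrict-≅ S y)

  restrict-agree-⊆ : ∀ {S L t t′} → S ⊆ L → restrict L t ≃ restrict L t′ → restrict S t ≃ restrict S t′
  restrict-agree-⊆ {S} {L} {t} {t′} S⊆L agree rewrite restrict-restrict S⊆L t | restrict-restrict S⊆L t′ =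
    bind agree
    where
    bind : ∀ {m n} → m ≃ n → (m >>= restrict S) ≃ (n >>= restrict S)
    bind nothing≃ = nothing≃
    bind (just≃ s≅t) = restrict-≅ S s≅t

  _≅?_ : ∀ s t → Dec (s ≅ t)
  leaf x ≅? leaf y with x ≟ y
  ... | yes refl = yes (leaf≅ x)
  ... | no x≢y = no (λ { (leaf≅ _) → x≢y refl })
  leaf x ≅? node _ _ = no (λ ())
  node _ _ ≅? leaf _ = no (λ ())
  node a b ≅? node c d with a ≅? c | b ≅? d | a ≅? d | b ≅? c
  ... | yes p | yes q | _ | _ = yes (node≅ p q)
  ... | _ | _ | yes p | yes q = yes (swap≅ p q)
  ... | no p | _ | no r | _ = no λ { (node≅ x _) → p x ; (swap≅ x _) → r x }
  ... | no p | _ | _ | no s = no λ { (node≅ x _) → p x ; (swap≅ _ y) → s y }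
  ... | _ | no q | no r | _ = no λ { (node≅ _ y) → q y ; (swap≅ x _) → r x }
  ... | _ | no q | _ | no s = no λ { (node≅ _ y) → q y ; (swap≅ _ y) → s y }

  _≃?_ : ∀ m n → Dec (m ≃ n)
  nothing ≃? nothing = yes nothing≃
  nothing ≃? just _ = no (λ ())
  just _ ≃? nothing = no (λ ())
  just s ≃? just t with s ≅? t
  ... | yes p = yes (just≃ p)
  ... | no ¬p = no (λ { (just≃ p) → ¬p p })

module SpanMembership where
  open Paths
  open Leaves
  open Spans
  open Restriction
  open import Data.Nat using (ℕ)
  open import Data.Bool using (Bool; true; false; not; _∧_; _∨_)
  open import Data.Bool.Properties using (∧-comm; ∨-comm; ∧-zeroʳ; ∨-zeroʳ; ∨-identityʳ)
  open import Data.List using (List; []; _∷_)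
  open import Data.List.Membership.Propositional using (_∈_)
  open import Data.List.Relation.Binary.Subset.Propositional using (_⊆_)
  open import Data.Maybe using (Maybe; just; nothing)
  open import Data.Product using (∃; _×_; _,_; proj₁; proj₂)
  open import Data.Sum using (_⊎_; inj₁; inj₂)
  open import Data.Empty using (⊥; ⊥-elim)
  open import Relation.Binary.PropositionalEquality hiding ([_])

  meets : Tree → List ℕ → Bool
  meets (leaf x) S = x ∈ᵇ S
  meets (node l r) S = meets l S ∨ meets r S

  -- memberᵇ span t S p decides whether p is a vertex of t[S]. Below a vertex of
  -- t[S] that has S-leaves outside the current subtree, the vertices of t[S] are
  -- exactly the ancestors of S-leaves, which memberᵇ above decides. Running both
  -- recursions for S and S′ at once, disjointᵇ is structural, hence invariant
  -- under restriction to a superset of S ∪ S′ and under isomorphism.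
  data Mode : Set where
    span above : Mode

  descend : Mode → Bool → Mode
  descend span true = above
  descend span false = span
  descend above _ = above

  atRoot : Mode → Bool → Bool → Bool
  atRoot span a b = a ∧ b
  atRoot above a b = a ∨ b

  memberᵇ : Mode → Tree → List ℕ → Pos → Bool
  memberᵇ k (leaf x) S [] = x ∈ᵇ S
  memberᵇ k (leaf x) S (_ ∷ _) = false
  memberᵇ k (node l r) S [] = atRoot k (meets l S) (meets r S)
  memberᵇ k (node l r) S (false ∷ p) = memberᵇ (descend k (meets r S)) l S p
  memberᵇ k (node l r) S (true ∷ p) = memberᵇ (descend k (meets l S)) r S p

  disjointᵇ : Mode → Mode → Tree → List ℕ → List ℕ → Bool
  disjointᵇ k k′ (leaf x) S S′ = not (x ∈ᵇ S ∧ x ∈ᵇ S′)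
  disjointᵇ k k′ (node l r) S S′ =
    not (atRoot k (meets l S) (meets r S) ∧ atRoot k′ (meets l S′) (meets r S′)) ∧
    (disjointᵇ (descend k (meets r S)) (descend k′ (meets r S′)) l S S′ ∧
     disjointᵇ (descend k (meets l S)) (descend k′ (meets l S′)) r S S′)

  ∧≡true⁻ : ∀ {a b} → a ∧ b ≡ true → a ≡ true × b ≡ true
  ∧≡true⁻ {true} {true} _ = refl , refl

  ∨≡true⁻ : ∀ {a b} → a ∨ b ≡ true → a ≡ true ⊎ b ≡ true
  ∨≡true⁻ {true} _ = inj₁ refl
  ∨≡true⁻ {false} {true} _ = inj₂ refl

  meets-true : ∀ {t S x p} → x ∈ S → LeafAt t p x → meets t S ≡ true
  meets-true {leaf y} {S} {p = []} x∈S refl = ∈⇒∈ᵇ x∈S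
  meets-true {leaf y} {p = _ ∷ _} x∈S ()
  meets-true {node l r} {p = []} x∈S ()
  meets-true {node l r} {S} {p = false ∷ p} x∈S lx rewrite meets-true {l} {S} {p = p} x∈S lx = refl
  meets-true {node l r} {S} {p = true ∷ p} x∈S lx rewrite meets-true {r} {S} {p = p} x∈S lx = ∨-zeroʳ (meets l S)

  meets⇒leaf : ∀ {t S} → meets t S ≡ true → ∃ λ x → ∃ λ p → x ∈ S × LeafAt t p x
  meets⇒leaf {leaf y} e = y , [] , ∈ᵇ⇒∈ e , refl
  meets⇒leaf {node l r} {S} e with ∨≡true⁻ {meets l S} e
  ... | inj₁ meets-c = let (x , p , x∈S , lx) = meets⇒leaf {l} meets-c in x , false ∷ p , x∈S , lx
  ... | inj₂ meets-c = let (x , p , x∈S , lx) = meets⇒leaf {r} meets-c in x , true ∷ p , x∈S , lx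

  meets-false : ∀ {t S x} p → meets t S ≡ false → x ∈ S → LeafAt t p x → ⊥
  meets-false {t} {S} p e x∈S lx with trans (sym e) (meets-true {t} {S} {p = p} x∈S lx)
  ... | ()

  Above⇒memberᵇ : ∀ t {S} p → Above t S p → memberᵇ above t S p ≡ true
  Above⇒memberᵇ (leaf y) [] (x , [] , x∈S , refl , _) = ∈⇒∈ᵇ x∈S
  Above⇒memberᵇ (node l r) {S} [] (x , false ∷ q , x∈S , lx , _) rewrite meets-true {l} {S} {p = q} x∈S lx = refl
  Above⇒memberᵇ (node l r) {S} [] (x , true ∷ q , x∈S , lx , _)
    rewrite meets-true {r} {S} {p = q} x∈S lx = ∨-zeroʳ (meets l S)
  Above⇒memberᵇ (node l r) (c ∷ p) (x , [] , x∈S , lx , cp⊑q) = ⊥-elim (∷⋢[] cp⊑q)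
  Above⇒memberᵇ (node l r) (c ∷ p) (x , d ∷ q , x∈S , lx , cp⊑q) with ⊑-∷⁻ cp⊑q
  ... | refl , p⊑q with c
  ...   | false = Above⇒memberᵇ l p (x , q , x∈S , lx , p⊑q)
  ...   | true = Above⇒memberᵇ r p (x , q , x∈S , lx , p⊑q)

  memberᵇ⇒Above : ∀ t {S} p → memberᵇ above t S p ≡ true → Above t S p
  memberᵇ⇒Above (leaf y) [] e = y , [] , ∈ᵇ⇒∈ e , refl , []⊑
  memberᵇ⇒Above (node l r) {S} [] e with meets⇒leaf {node l r} {S} e
  ... | x , q , x∈S , lx = x , q , x∈S , lx , []⊑
  memberᵇ⇒Above (node l r) (false ∷ p) e with memberᵇ⇒Above l p e
  ... | x , q , x∈S , lx , p⊑q = x , false ∷ q , x∈S , lx , ⊑-∷⁺ p⊑q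
  memberᵇ⇒Above (node l r) (true ∷ p) e with memberᵇ⇒Above r p e
  ... | x , q , x∈S , lx , p⊑q = x , true ∷ q , x∈S , lx , ⊑-∷⁺ p⊑q

  InSpan⇒memberᵇ : ∀ t {S} r → InSpan t S r → memberᵇ span t S r ≡ true
  InSpan⇒memberᵇ (leaf y) [] (x , _ , [] , [] , x∈S , _ , refl , refl , _) = ∈⇒∈ᵇ x∈S
  InSpan⇒memberᵇ (leaf y) (_ ∷ _) (_ , _ , [] , [] , _ , _ , refl , refl , o) with () ← OnPath-refl⁻ {[]} o
  InSpan⇒memberᵇ (node l r) {S} [] (x , y , p , q , x∈S , y∈S , lx , ly , (_ , l⊑[])) = at-root p q lx ly l⊑[]
    where
    at-root : ∀ p q → LeafAt (node l r) p x → LeafAt (node l r) q y → lcp p q ⊑ [] →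
      (meets l S ∧ meets r S) ≡ true
    at-root (false ∷ p) (false ∷ q) _ _ l⊑[] = ⊥-elim (∷⋢[] l⊑[])
    at-root (true ∷ p) (true ∷ q) _ _ l⊑[] = ⊥-elim (∷⋢[] l⊑[])
    at-root (false ∷ p) (true ∷ q) lx ly _
      rewrite meets-true {l} {S} {p = p} x∈S lx | meets-true {r} {S} {p = q} y∈S ly = refl
    at-root (true ∷ p) (false ∷ q) lx ly _
      rewrite meets-true {l} {S} {p = q} y∈S ly | meets-true {r} {S} {p = p} x∈S lx = refl
  InSpan⇒memberᵇ (node l r) {S} (false ∷ s) s∈ with meets r S in eq
  ... | true with InSpan⇒Above s∈
  ...   | x , false ∷ q , x∈S , lx , s⊑q = Above⇒memberᵇ l s (x , q , x∈S , lx , proj₂ (⊑-∷⁻ s⊑q))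
  ...   | _ , true ∷ _ , _ , _ , s⊑q with () ← proj₁ (⊑-∷⁻ s⊑q)
  InSpan⇒memberᵇ (node l r) {S} (false ∷ s) (x , y , p , q , x∈S , y∈S , lx , ly , o) | false =
    InSpan⇒memberᵇ l s (in-left p q lx ly o)
    where
    in-left : ∀ p q → LeafAt (node l r) p x → LeafAt (node l r) q y → OnPath p q (false ∷ s) → InSpan l S s
    in-left (true ∷ p) _ lx _ _ = ⊥-elim (meets-false {r} p eq x∈S lx)
    in-left (false ∷ p) (true ∷ q) _ ly _ = ⊥-elim (meets-false {r} q eq y∈S ly)
    in-left (false ∷ p) (false ∷ q) lx ly o = x , y , p , q , x∈S , y∈S , lx , ly , OnPath-∷⁻ false o
  InSpan⇒memberᵇ (node l r) {S} (true ∷ s) s∈ with meets l S in eq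
  ... | true with InSpan⇒Above s∈
  ...   | x , true ∷ q , x∈S , lx , s⊑q = Above⇒memberᵇ r s (x , q , x∈S , lx , proj₂ (⊑-∷⁻ s⊑q))
  ...   | _ , false ∷ _ , _ , _ , s⊑q with () ← proj₁ (⊑-∷⁻ s⊑q)
  InSpan⇒memberᵇ (node l r) {S} (true ∷ s) (x , y , p , q , x∈S , y∈S , lx , ly , o) | false =
    InSpan⇒memberᵇ r s (in-right p q lx ly o)
    where
    in-right : ∀ p q → LeafAt (node l r) p x → LeafAt (node l r) q y → OnPath p q (true ∷ s) → InSpan r S s
    in-right (false ∷ p) _ lx _ _ = ⊥-elim (meets-false {l} p eq x∈S lx)
    in-right (true ∷ p) (false ∷ q) _ ly _ = ⊥-elim (meets-false {l} q eq y∈S ly)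
    in-right (true ∷ p) (true ∷ q) lx ly o = x , y , p , q , x∈S , y∈S , lx , ly , OnPath-∷⁻ true o

  memberᵇ⇒InSpan : ∀ t {S} r → memberᵇ span t S r ≡ true → InSpan t S r
  memberᵇ⇒InSpan (leaf y) [] e = y , y , [] , [] , ∈ᵇ⇒∈ e , ∈ᵇ⇒∈ e , refl , refl , OnPath-refl []
  memberᵇ⇒InSpan (node l r) {S} [] e with ∧≡true⁻ {meets l S} e
  ... | l-meets , r-meets with meets⇒leaf {l} l-meets | meets⇒leaf {r} r-meets
  ...   | x , p , x∈S , lx | y , q , y∈S , ly =
    x , y , false ∷ p , true ∷ q , x∈S , y∈S , lx , ly , (inj₁ []⊑ , []⊑)
  memberᵇ⇒InSpan (node l r) {S} (false ∷ s) e with meets r S in eq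
  ... | true with memberᵇ⇒Above l s e | meets⇒leaf {r} eq
  ...   | x , p , x∈S , lx , s⊑p | y , q , y∈S , ly =
    x , y , false ∷ p , true ∷ q , x∈S , y∈S , lx , ly , (inj₁ (⊑-∷⁺ s⊑p) , []⊑)
  memberᵇ⇒InSpan (node l r) {S} (false ∷ s) e | false with memberᵇ⇒InSpan l s e
  ... | x , y , p , q , x∈S , y∈S , lx , ly , o =
    x , y , false ∷ p , false ∷ q , x∈S , y∈S , lx , ly , OnPath-∷⁺ false o
  memberᵇ⇒InSpan (node l r) {S} (true ∷ s) e with meets l S in eq
  ... | true with memberᵇ⇒Above r s e | meets⇒leaf {l} eq
  ...   | x , p , x∈S , lx , s⊑p | y , q , y∈S , ly =
    x , y , true ∷ p , false ∷ q , x∈S , y∈S , lx , ly , (inj₁ (⊑-∷⁺ s⊑p) , []⊑)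
  memberᵇ⇒InSpan (node l r) {S} (true ∷ s) e | false with memberᵇ⇒InSpan r s e
  ... | x , y , p , q , x∈S , y∈S , lx , ly , o =
    x , y , true ∷ p , true ∷ q , x∈S , y∈S , lx , ly , OnPath-∷⁺ true o

  memberᵇ⇒Above′ : ∀ k t {S} r → memberᵇ k t S r ≡ true → Above t S r
  memberᵇ⇒Above′ span t r e = InSpan⇒Above (memberᵇ⇒InSpan t r e)
  memberᵇ⇒Above′ above t r e = memberᵇ⇒Above t r e

  disjointᵇ-sound : ∀ k k′ t {S S′} → disjointᵇ k k′ t S S′ ≡ true →
    ∀ p → memberᵇ k t S p ≡ true → memberᵇ k′ t S′ p ≡ true → ⊥
  disjointᵇ-sound k k′ (leaf x) disj [] m m′ rewrite m | m′ with () ← disj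
  disjointᵇ-sound k k′ (node l r) disj [] m m′ rewrite m | m′ with () ← disj
  disjointᵇ-sound k k′ (node l r) {S} {S′} disj (c ∷ p) m m′
    with ∧≡true⁻ {not (atRoot k (meets l S) (meets r S) ∧ atRoot k′ (meets l S′) (meets r S′))} disj
  ... | _ , children
    with ∧≡true⁻ {disjointᵇ (descend k (meets r S)) (descend k′ (meets r S′)) l S S′} children | c
  ...   | l-disj , _ | false = disjointᵇ-sound _ _ l l-disj p m m′
  ...   | _ , r-disj | true = disjointᵇ-sound _ _ r r-disj p m m′

  disjointᵇ-complete : ∀ k k′ t {S S′} →
    (∀ p → memberᵇ k t S p ≡ true → memberᵇ k′ t S′ p ≡ true → ⊥) → disjointᵇ k k′ t S S′ ≡ true
  disjointᵇ-complete k k′ (leaf x) {S} {S′} f with x ∈ᵇ S in m | x ∈ᵇ S′ in m′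
  ... | true | true = ⊥-elim (f [] m m′)
  ... | true | false = refl
  ... | false | _ = refl
  disjointᵇ-complete k k′ (node l r) {S} {S′} f
    rewrite disjointᵇ-complete (descend k (meets r S)) (descend k′ (meets r S′)) l {S} {S′} (λ p → f (false ∷ p))
          | disjointᵇ-complete (descend k (meets l S)) (descend k′ (meets l S′)) r {S} {S′} (λ p → f (true ∷ p))
    with atRoot k (meets l S) (meets r S) in m | atRoot k′ (meets l S′) (meets r S′) in m′
  ... | true | true = ⊥-elim (f [] m m′)
  ... | true | false = refl
  ... | false | _ = refl

  SpanDisjoint⇒disjointᵇ : ∀ t {S S′} → SpanDisjoint t S S′ → disjointᵇ span span t S S′ ≡ true
  SpanDisjoint⇒disjointᵇ t disj = disjointᵇ-complete span span t
    (λ p m m′ → disj p (memberᵇ⇒InSpan t p m) (memberᵇ⇒InSpan t p m′))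

  disjointᵇ⇒SpanDisjoint : ∀ t {S S′} → disjointᵇ span span t S S′ ≡ true → SpanDisjoint t S S′
  disjointᵇ⇒SpanDisjoint t disj r r∈S r∈S′ =
    disjointᵇ-sound span span t disj r (InSpan⇒memberᵇ t r r∈S) (InSpan⇒memberᵇ t r r∈S′)

  disjointᵇ-no-leaf : ∀ k k′ t {S S′} → meets t S ≡ false → disjointᵇ k k′ t S S′ ≡ true
  disjointᵇ-no-leaf k k′ t no-leaf = disjointᵇ-complete k k′ t λ p m _ →
    let (x , q , x∈S , lx , _) = memberᵇ⇒Above′ k t p m in meets-false {t} q no-leaf x∈S lx

  disjointᵇ-above : ∀ t {S S′} → meets t S ≡ true → meets t S′ ≡ true → disjointᵇ above above t S S′ ≡ false
  disjointᵇ-above t {S} {S′} meets-S meets-S′ with disjointᵇ above above t S S′ in disj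
  ... | false = refl
  ... | true with meets⇒leaf {t} meets-S | meets⇒leaf {t} meets-S′
  ...   | x , p , x∈S , lx | y , q , y∈S′ , ly = ⊥-elim (disjointᵇ-sound above above t disj []
          (Above⇒memberᵇ t [] (x , p , x∈S , lx , []⊑)) (Above⇒memberᵇ t [] (y , q , y∈S′ , ly , []⊑)))

  meetsᴹ : Maybe Tree → List ℕ → Bool
  meetsᴹ nothing S = false
  meetsᴹ (just t) S = meets t S

  meets-combine : ∀ a b S → meetsᴹ (combine a b) S ≡ meetsᴹ a S ∨ meetsᴹ b S
  meets-combine (just a) (just b) S = refl
  meets-combine (just a) nothing S = sym (∨-identityʳ _)
  meets-combine nothing (just b) S = refl
  meets-combine nothing nothing S = refl

  meets-restrict : ∀ {S L} → S ⊆ L → ∀ t → meetsᴹ (restrict L t) S ≡ meets t S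
  meets-restrict {S} {L} S⊆L (leaf x) with x ∈ᵇ L in e
  ... | true = refl
  ... | false with x ∈ᵇ S in meets-c
  ... | false = refl
  ... | true with () ← trans (sym (∈⇒∈ᵇ (S⊆L (∈ᵇ⇒∈ meets-c)))) e
  meets-restrict {S} {L} S⊆L (node l r) rewrite restrict-node L l r
    | meets-combine (restrict L l) (restrict L r) S | meets-restrict S⊆L l | meets-restrict S⊆L r = refl

  disjointᵇ-restrict : ∀ {S S′ L} → S ⊆ L → S′ ⊆ L →
    ∀ t {t′} → restrict L t ≡ just t′ → ∀ k k′ → disjointᵇ k k′ t S S′ ≡ disjointᵇ k k′ t′ S S′
  disjointᵇ-restrict {S} {S′} {L} S⊆L S′⊆L (leaf x) eq k k′ with x ∈ᵇ L
  disjointᵇ-restrict {S} {S′} {L} S⊆L S′⊆L (leaf x) refl k k′ | true = refl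
  disjointᵇ-restrict {S} {S′} {L} S⊆L S′⊆L (leaf x) () k k′ | false
  disjointᵇ-restrict {S} {S′} {L} S⊆L S′⊆L (node l r) {t′} eq k k′
    with restrict L l in eqˡ | restrict L r in eqʳ | trans (sym (restrict-node L l r)) eq
  ... | just a | just b | refl
    rewrite sym (meets-restrict S⊆L l) | sym (meets-restrict S⊆L r)
          | sym (meets-restrict S′⊆L l) | sym (meets-restrict S′⊆L r)
          | eqˡ | eqʳ
          | disjointᵇ-restrict S⊆L S′⊆L l eqˡ (descend k (meets b S)) (descend k′ (meets b S′))
          | disjointᵇ-restrict S⊆L S′⊆L r eqʳ (descend k (meets a S)) (descend k′ (meets a S′)) = refl
  ... | just a | nothing | refl
    rewrite sym (meets-restrict S⊆L l) | sym (meets-restrict S⊆L r)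
          | sym (meets-restrict S′⊆L l) | sym (meets-restrict S′⊆L r)
          | eqˡ | eqʳ
          | disjointᵇ-no-leaf (descend k (meets a S)) (descend k′ (meets a S′)) r {S} {S′}
              (trans (sym (meets-restrict S⊆L r)) (cong (λ m → meetsᴹ m S) eqʳ))
          | ∧-comm (disjointᵇ (descend k false) (descend k′ false) l S S′) true
    = pruned k k′
    where
    pruned : ∀ k k′ → not (atRoot k (meets a S) false ∧ atRoot k′ (meets a S′) false) ∧
                        disjointᵇ (descend k false) (descend k′ false) l S S′ ≡ disjointᵇ k k′ a S S′
    pruned span span rewrite ∧-zeroʳ (meets a S) = disjointᵇ-restrict S⊆L S′⊆L l eqˡ span span
    pruned span above rewrite ∧-zeroʳ (meets a S) = disjointᵇ-restrict S⊆L S′⊆L l eqˡ span above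
    pruned above span rewrite ∧-zeroʳ (meets a S′) | ∧-zeroʳ (meets a S ∨ false) =
      disjointᵇ-restrict S⊆L S′⊆L l eqˡ above span
    pruned above above rewrite ∨-identityʳ (meets a S) | ∨-identityʳ (meets a S′)
      with meets a S in meets-S | meets a S′ in meets-S′
    ... | false | _ = disjointᵇ-restrict S⊆L S′⊆L l eqˡ above above
    ... | true | false = disjointᵇ-restrict S⊆L S′⊆L l eqˡ above above
    ... | true | true = sym (disjointᵇ-above a meets-S meets-S′)
  ... | nothing | just b | refl
    rewrite sym (meets-restrict S⊆L l) | sym (meets-restrict S⊆L r)
          | sym (meets-restrict S′⊆L l) | sym (meets-restrict S′⊆L r)
          | eqˡ | eqʳ
          | disjointᵇ-no-leaf (descend k (meets b S)) (descend k′ (meets b S′)) l {S} {S′}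
              (trans (sym (meets-restrict S⊆L l)) (cong (λ m → meetsᴹ m S) eqˡ))
    = pruned k k′
    where
    pruned : ∀ k k′ → not (atRoot k false (meets b S) ∧ atRoot k′ false (meets b S′)) ∧
                        disjointᵇ (descend k false) (descend k′ false) r S S′ ≡ disjointᵇ k k′ b S S′
    pruned span span = disjointᵇ-restrict S⊆L S′⊆L r eqʳ span span
    pruned span above = disjointᵇ-restrict S⊆L S′⊆L r eqʳ span above
    pruned above span rewrite ∧-zeroʳ (meets b S) = disjointᵇ-restrict S⊆L S′⊆L r eqʳ above span
    pruned above above with meets b S in meets-S | meets b S′ in meets-S′
    ... | false | _ = disjointᵇ-restrict S⊆L S′⊆L r eqʳ above above
    ... | true | false = disjointᵇ-restrict S⊆L S′⊆L r eqʳ above above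
    ... | true | true = sym (disjointᵇ-above b meets-S meets-S′)
  ... | nothing | nothing | ()

  meets-≅ : ∀ {s t} S → s ≅ t → meets s S ≡ meets t S
  meets-≅ S (leaf≅ x) = refl
  meets-≅ S (node≅ a b) rewrite meets-≅ S a | meets-≅ S b = refl
  meets-≅ S (swap≅ {a} {b} {c} {d} x y) rewrite meets-≅ S x | meets-≅ S y = ∨-comm (meets d S) (meets c S)

  atRoot-comm : ∀ k a b → atRoot k a b ≡ atRoot k b a
  atRoot-comm span a b = ∧-comm a b
  atRoot-comm above a b = ∨-comm a b

  disjointᵇ-≅ : ∀ {s t} {S S′} → s ≅ t → ∀ k k′ → disjointᵇ k k′ s S S′ ≡ disjointᵇ k k′ t S S′
  disjointᵇ-≅ (leaf≅ x) k k′ = refl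
  disjointᵇ-≅ {S = S} {S′} (node≅ {a} {b} {c} {d} x y) k k′
    rewrite meets-≅ S x | meets-≅ S y | meets-≅ S′ x | meets-≅ S′ y
          | disjointᵇ-≅ {S = S} {S′} x (descend k (meets d S)) (descend k′ (meets d S′))
          | disjointᵇ-≅ {S = S} {S′} y (descend k (meets c S)) (descend k′ (meets c S′)) = refl
  disjointᵇ-≅ {S = S} {S′} (swap≅ {a} {b} {c} {d} x y) k k′
    rewrite meets-≅ S x | meets-≅ S y | meets-≅ S′ x | meets-≅ S′ y
          | disjointᵇ-≅ {S = S} {S′} x (descend k (meets c S)) (descend k′ (meets c S′))
          | disjointᵇ-≅ {S = S} {S′} y (descend k (meets d S)) (descend k′ (meets d S′))
          | atRoot-comm k (meets d S) (meets c S) | atRoot-comm k′ (meets d S′) (meets c S′)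
          | ∧-comm (disjointᵇ (descend k (meets c S)) (descend k′ (meets c S′)) d S S′)
                   (disjointᵇ (descend k (meets d S)) (descend k′ (meets d S′)) c S S′) = refl

  SpanDisjoint-transfer : ∀ {t t′ L S S′} → S ⊆ L → S′ ⊆ L →
    restrict L t ≃ restrict L t′ → SpanDisjoint t S S′ → SpanDisjoint t′ S S′
  SpanDisjoint-transfer {t} {t′} {L} {S} {S′} S⊆L S′⊆L agree disj
    with restrict L t in eq | restrict L t′ in eq′ | agree
  ... | nothing | nothing | nothing≃ = disjointᵇ⇒SpanDisjoint t′ (disjointᵇ-no-leaf span span t′
    (trans (sym (meets-restrict S⊆L t′)) (cong (λ m → meetsᴹ m S) eq′)))
  ... | just s | just s′ | just≃ s≅s′ = disjointᵇ⇒SpanDisjoint t′ (begin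
    disjointᵇ span span t′ S S′ ≡⟨ disjointᵇ-restrict S⊆L S′⊆L t′ eq′ span span ⟩
    disjointᵇ span span s′ S S′ ≡⟨ disjointᵇ-≅ s≅s′ span span ⟨
    disjointᵇ span span s S S′  ≡⟨ disjointᵇ-restrict S⊆L S′⊆L t eq span span ⟨
    disjointᵇ span span t S S′  ≡⟨ SpanDisjoint⇒disjointᵇ t disj ⟩
    true                        ∎)
    where open ≡-Reasoning

module Minimisation where
  open import Data.Nat using (ℕ; _≤_)
  open import Data.List using (filter)
  open import Data.List.Extrema.Nat using (argmin; argmin-all; f[argmin]≤f[xs])
  open import Data.List.Membership.Propositional using (_∈_)
  open import Data.List.Membership.Propositional.Properties using (∈-filter⁺)
  open import Data.List.Relation.Unary.All as All using ()
  open import Data.List.Relation.Unary.All.Properties using (all-filter; filter⁺)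
  open import Data.Product using (∃; _×_; _,_)
  open import Relation.Unary using (Decidable)

  ∃-minimal : ∀ {A : Set} {P : A → Set} (f : A → ℕ) → Decidable P → ∀ xs →
    (∃ λ x → x ∈ xs × P x) → ∃ λ m → m ∈ xs × P m × (∀ {y} → y ∈ xs → P y → f m ≤ f y)
  ∃-minimal f P? xs (x , x∈xs , Px) =
    argmin f x (filter P? xs) ,
    argmin-all f x∈xs (filter⁺ P? (All.tabulate (λ y∈xs → y∈xs))) ,
    argmin-all f Px (all-filter P? xs) ,
    λ y∈xs Py → All.lookup (f[argmin]≤f[xs] x (filter P? xs)) (∈-filter⁺ P? y∈xs Py)

module Forests (T tA tB tC : Tree) where
  open Restriction
  open SpanMembership
  open import Data.Nat using (ℕ)
  open import Data.Nat.Properties using (_≟_)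
  open import Data.Bool using (true)
  open import Data.Bool.Properties using () renaming (_≟_ to _≟ᵇ_)
  open import Data.List using (List; []; _∷_; length; lookup; concat)
  open import Data.List.Properties using (tabulate-lookup)
  open import Data.List.Membership.Propositional using (_∈_)
  open import Data.List.Membership.Propositional.Properties using (∈-lookup)
  open import Data.List.Membership.Propositional.Properties.WithK using (unique∧set⇒bag)
  open import Data.List.Relation.Binary.BagAndSetEquality using (∼bag⇒↭)
  open import Data.List.Relation.Binary.Subset.Propositional using (_⊆_)
  open import Data.List.Relation.Binary.Subset.DecPropositional _≟_ using (_⊆?_)
  open import Data.List.Relation.Binary.Permutation.Propositional
    using (_↭_; refl; prep; swap; trans; ↭-sym; ↭-trans; ↭⇒↭ₛ)
  open import Data.List.Relation.Binary.Permutation.Propositional.Properties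
    using (All-resp-↭; ∈-resp-↭; ++⁺ˡ; shifts)
  import Data.List.Relation.Binary.Permutation.Setoid.Properties as Permutationₛ
  open import Data.List.Relation.Unary.All as All using (All; []; _∷_; all?)
  open import Data.List.Relation.Unary.All.Properties as All using ()
  open import Data.List.Relation.Unary.AllPairs as AllPairs using (AllPairs; []; _∷_; allPairs?)
  open import Data.List.Relation.Unary.AllPairs.Properties as AllPairs using ()
  open import Data.List.Relation.Unary.Unique.Propositional using (Unique)
  open import Data.List.Relation.Unary.Any using (here; there)
  open import Data.Fin using (Fin; zero; suc)
  open import Data.Product using (_×_; _,_; proj₁; proj₂)
  open import Data.Sum using (_⊎_; inj₁; inj₂)
  open import Data.Empty using (⊥-elim)
  open import Function.Bundles using (mk⇔)
  open import Relation.Nullary using (Dec; yes; no; ¬?)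
  open import Relation.Nullary.Decidable using (map′; _→-dec_; _×-dec_; _⊎-dec_)
  open import Relation.Binary.Definitions using (Symmetric)
  open import Relation.Binary.PropositionalEquality using (_≡_; _≢_; refl; cong; subst; setoid)
  open import Relation.Binary.PropositionalEquality.Core using (resp₂)

  IsComponent : Tree → Set
  IsComponent D = D ≡ tA ⊎ D ≡ tB ⊎ D ≡ tC

  Refines : List ℕ → Set
  Refines S = S ⊆ leaves tA ⊎ S ⊆ leaves tB ⊎ S ⊆ leaves tC

  Agrees : List ℕ → Set
  Agrees S = ∀ D → IsComponent D → S ⊆ leaves D → restrict S T ≃ restrict S D

  ValidBlock : List ℕ → Set
  ValidBlock S = (S ≢ []) × Refines S × Agrees S

  DisjointInForest : List ℕ → List ℕ → Set
  DisjointInForest S S′ = ∀ D → IsComponent D → S ⊆ leaves D → S′ ⊆ leaves D → SpanDisjoint D S S′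

  Separated : List ℕ → List ℕ → Set
  Separated S S′ = SpanDisjoint T S S′ × DisjointInForest S S′

  Separated-sym : Symmetric Separated
  Separated-sym (inT , inF) = (λ r i j → inT r j i) , (λ D c s s′ r i j → inF D c s′ s r j i)

  -- ReachableAF with the pairwise conditions stated on the list of blocks
  -- rather than through Fin-indexed lookups.
  record AgreementForest (P : List (List ℕ)) : Set where
    constructor mkAF
    field
      valid     : All ValidBlock P
      partition : concat P ↭ leaves T
      separated : AllPairs Separated P

  private
    AllPairs-lookup : ∀ {A : Set} {R : A → A → Set} → Symmetric R →
      ∀ {P} → AllPairs R P → ∀ (i j : Fin (length P)) → i ≢ j → R (lookup P i) (lookup P j)
    AllPairs-lookup sym (_ ∷ _) zero zero i≢j = ⊥-elim (i≢j refl)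
    AllPairs-lookup sym (Rx ∷ _) zero (suc j) _ = All.lookup Rx (∈-lookup j)
    AllPairs-lookup sym (Rx ∷ _) (suc i) zero _ = sym (All.lookup Rx (∈-lookup i))
    AllPairs-lookup sym (_ ∷ R*) (suc i) (suc j) i≢j = AllPairs-lookup sym R* i j (λ i≡j → i≢j (cong suc i≡j))

  AgreementForest⇒Reachable : ∀ {P} → AgreementForest P → ReachableAF T tA tB tC P
  AgreementForest⇒Reachable (mkAF valid partition separated) = record
    { nonempty  = All.map proj₁ valid
    ; partition = partition
    ; refines   = All.map (λ v → proj₁ (proj₂ v)) valid
    ; agree     = λ i → proj₂ (proj₂ (All.lookup valid (∈-lookup i)))
    ; disjT     = λ i j i≢j → proj₁ (AllPairs-lookup Separated-sym separated i j i≢j)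
    ; disjF     = λ i j i≢j → proj₂ (AllPairs-lookup Separated-sym separated i j i≢j)
    }

  Reachable⇒AgreementForest : ∀ {P} → ReachableAF T tA tB tC P → AgreementForest P
  Reachable⇒AgreementForest {P} r = mkAF
    (subst (All ValidBlock) (tabulate-lookup P)
      (All.tabulate⁺ (λ i → All.lookup nonempty (∈-lookup i) , All.lookup refines (∈-lookup i) , agree i)))
    partition
    (subst (AllPairs Separated) (tabulate-lookup P)
      (AllPairs.tabulate⁺ (λ {i} {j} i≢j → disjT i j i≢j , disjF i j i≢j)))
    where open ReachableAF r

  module _ {A : Set} where

    AllPairs-resp-↭ : ∀ {R : A → A → Set} → Symmetric R → ∀ {P Q} → P ↭ Q → AllPairs R P → AllPairs R Q
    AllPairs-resp-↭ {R} sym P↭Q = Permutationₛ.AllPairs-resp-↭ (setoid A) sym (resp₂ R) (↭⇒↭ₛ P↭Q)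

    Unique-resp-↭ : ∀ {xs ys : List A} → xs ↭ ys → Unique xs → Unique ys
    Unique-resp-↭ xs↭ys = Permutationₛ.Unique-resp-↭ (setoid A) (↭⇒↭ₛ xs↭ys)

    concat-↭ : ∀ {P Q : List (List A)} → P ↭ Q → concat P ↭ concat Q
    concat-↭ refl = refl
    concat-↭ (prep x P↭Q) = ++⁺ˡ x (concat-↭ P↭Q)
    concat-↭ (swap x y P↭Q) = ↭-trans (shifts x y) (++⁺ˡ y (++⁺ˡ x (concat-↭ P↭Q)))
    concat-↭ (trans P↭Q Q↭R) = ↭-trans (concat-↭ P↭Q) (concat-↭ Q↭R)

  AgreementForest-resp-↭ : ∀ {P Q} → P ↭ Q → AgreementForest P → AgreementForest Q
  AgreementForest-resp-↭ P↭Q (mkAF valid partition separated) = mkAF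
    (All-resp-↭ P↭Q valid)
    (↭-trans (concat-↭ (↭-sym P↭Q)) partition)
    (AllPairs-resp-↭ Separated-sym P↭Q separated)

  InSpan? : ∀ t S r → Dec (InSpan t S r)
  InSpan? t S r = map′ (memberᵇ⇒InSpan t r) (InSpan⇒memberᵇ t r) (memberᵇ span t S r ≟ᵇ true)

  SpanDisjoint? : ∀ t S S′ → Dec (SpanDisjoint t S S′)
  SpanDisjoint? t S S′ = map′ (disjointᵇ⇒SpanDisjoint t) (SpanDisjoint⇒disjointᵇ t)
    (disjointᵇ span span t S S′ ≟ᵇ true)

  private
    components : List Tree
    components = tA ∷ tB ∷ tC ∷ []

    IsComponent⇒∈ : ∀ {D} → IsComponent D → D ∈ components
    IsComponent⇒∈ (inj₁ refl) = here refl
    IsComponent⇒∈ (inj₂ (inj₁ refl)) = there (here refl)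
    IsComponent⇒∈ (inj₂ (inj₂ refl)) = there (there (here refl))

    ∈⇒IsComponent : ∀ {D} → D ∈ components → IsComponent D
    ∈⇒IsComponent (here refl) = inj₁ refl
    ∈⇒IsComponent (there (here refl)) = inj₂ (inj₁ refl)
    ∈⇒IsComponent (there (there (here refl))) = inj₂ (inj₂ refl)

    ∀-component? : {Q : Tree → Set} → (∀ D → Dec (Q D)) → Dec (∀ D → IsComponent D → Q D)
    ∀-component? Q? = map′ (λ all D c → All.lookup all (IsComponent⇒∈ c))
      (λ f → All.tabulate (λ D∈ → f _ (∈⇒IsComponent D∈)))
      (all? Q? components)

    nonempty? : ∀ (S : List ℕ) → Dec (S ≢ [])
    nonempty? [] = no (λ S≢[] → S≢[] refl)
    nonempty? (_ ∷ _) = yes (λ ())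

  ValidBlock? : ∀ S → Dec (ValidBlock S)
  ValidBlock? S = nonempty? S ×-dec
    (((S ⊆? leaves tA) ⊎-dec ((S ⊆? leaves tB) ⊎-dec (S ⊆? leaves tC))) ×-dec
     ∀-component? (λ D → (S ⊆? leaves D) →-dec (restrict S T ≃? restrict S D)))

  Separated? : ∀ S S′ → Dec (Separated S S′)
  Separated? S S′ = SpanDisjoint? T S S′ ×-dec
    ∀-component? (λ D → (S ⊆? leaves D) →-dec ((S′ ⊆? leaves D) →-dec SpanDisjoint? D S S′))

  ↭-unique-set : ∀ {xs ys : List ℕ} → Unique xs → Unique ys → xs ⊆ ys → ys ⊆ xs → xs ↭ ys
  ↭-unique-set ux uy xs⊆ys ys⊆xs = ∼bag⇒↭ (unique∧set⇒bag ux uy (mk⇔ xs⊆ys ys⊆xs))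

  private
    ↭-leaves? : Phylo T → ∀ (xs : List ℕ) → Dec (xs ↭ leaves T)
    ↭-leaves? phT xs with allPairs? (λ x y → ¬? (x ≟ y)) xs | xs ⊆? leaves T | leaves T ⊆? xs
    ... | yes u | yes xs⊆L | yes L⊆xs = yes (↭-unique-set u phT xs⊆L L⊆xs)
    ... | no ¬u | _ | _ = no (λ xs↭L → ¬u (Unique-resp-↭ (↭-sym xs↭L) phT))
    ... | _ | no ¬xs⊆L | _ = no (λ xs↭L → ¬xs⊆L (∈-resp-↭ xs↭L))
    ... | _ | _ | no ¬L⊆xs = no (λ xs↭L → ¬L⊆xs (∈-resp-↭ (↭-sym xs↭L)))

  AgreementForest? : Phylo T → ∀ P → Dec (AgreementForest P)
  AgreementForest? phT P with all? ValidBlock? P | ↭-leaves? phT (concat P) | allPairs? Separated? P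
  ... | yes v | yes p | yes s = yes (mkAF v p s)
  ... | no ¬v | _ | _ = no (λ af → ¬v (AgreementForest.valid af))
  ... | _ | no ¬p | _ = no (λ af → ¬p (AgreementForest.partition af))
  ... | _ | _ | no ¬s = no (λ af → ¬s (AgreementForest.separated af))

module MinimumForest (T tA tB tC : Tree) (phT : Phylo T) (phA : Phylo tA) (phB : Phylo tB) (phC : Phylo tC)
  (partition : (leaves tA ++ leaves tB ++ leaves tC) ↭ leaves T) where
  open Leaves
  open Spans
  open Restriction
  open Minimisation
  open Forests T tA tB tC
  open import Data.Nat using (ℕ; zero; suc; _≤_; z≤n; s≤s)
  open import Data.Nat.Properties using (_≟_; ≤-trans; ≤-reflexive; m≤n+m)
  open import Data.List using (List; []; _∷_; [_]; length; concat; map; filter; concatMap)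
  open import Data.List.Properties using (length-map; length-++)
  open import Data.List.Membership.Propositional using (_∈_)
  open import Data.List.Membership.DecPropositional _≟_ using (_∈?_)
  open import Data.List.Membership.Propositional.Properties
    using (∈-++⁺ˡ; ∈-++⁺ʳ; ∈-++⁻; ∈-map⁺; ∈-filter⁺; ∈-filter⁻; ∈-concatMap⁺; ∈-concat⁺′)
  open import Data.List.Relation.Binary.Subset.Propositional using (_⊆_)
  open import Data.List.Relation.Binary.Permutation.Propositional using (↭-sym; ↭-trans; ↭-refl; ↭-reflexive)
  open import Data.List.Relation.Binary.Permutation.Propositional.Properties using (∈-resp-↭; ++⁺; ↭-length)
  open import Data.List.Relation.Unary.All as All using (All; []; _∷_)
  open import Data.List.Relation.Unary.All.Properties as All using ()
  open import Data.List.Relation.Unary.AllPairs as AllPairs using (AllPairs; []; _∷_)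
  open import Data.List.Relation.Unary.AllPairs.Properties as AllPairs using ()
  open import Data.List.Relation.Unary.Unique.Propositional using (Unique)
  open import Data.List.Relation.Unary.Unique.Propositional.Properties as Unique using ()
  open import Data.List.Relation.Unary.Any as Any using (here; there)
  open import Data.Product using (∃; _×_; _,_; proj₁; proj₂)
  open import Data.Sum using (inj₁; inj₂)
  open import Data.Empty using (⊥-elim)
  open import Relation.Nullary using (yes; no)
  open import Relation.Binary.PropositionalEquality using (_≡_; _≢_; refl; sym; trans; cong; subst)

  private
    module _ {A : Set} where

      sublists : List A → List (List A)
      sublists [] = [] ∷ []
      sublists (x ∷ xs) = map (x ∷_) (sublists xs) ++ sublists xs

      listsUpTo : ℕ → List A → List (List A)
      listsUpTo zero xs = [] ∷ []
      listsUpTo (suc k) xs = [] ∷ concatMap (λ a → map (a ∷_) (listsUpTo k xs)) xs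

      ∈-listsUpTo : ∀ k xs (ys : List A) → length ys ≤ k → All (_∈ xs) ys → ys ∈ listsUpTo k xs
      ∈-listsUpTo zero xs [] _ _ = here refl
      ∈-listsUpTo (suc k) xs [] _ _ = here refl
      ∈-listsUpTo (suc k) xs (y ∷ ys) (s≤s |ys|≤k) (y∈xs ∷ ys⊆xs) =
        there (∈-concatMap⁺ (λ a → map (a ∷_) (listsUpTo k xs))
        (Any.map (λ { refl → ∈-map⁺ (y ∷_) (∈-listsUpTo k xs ys |ys|≤k ys⊆xs) }) y∈xs))

      length≤length-concat : ∀ (P : List (List A)) → All (_≢ []) P → length P ≤ length (concat P)
      length≤length-concat [] _ = z≤n
      length≤length-concat ([] ∷ P) ([]≢[] ∷ _) = ⊥-elim ([]≢[] refl)
      length≤length-concat ((x ∷ S) ∷ P) (_ ∷ ne) rewrite length-++ (x ∷ S) {concat P} =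
        s≤s (≤-trans (length≤length-concat P ne) (m≤n+m _ _))

      Unique-concat⁻ : ∀ (P : List (List A)) → Unique (concat P) → All Unique P
      Unique-concat⁻ [] _ = []
      Unique-concat⁻ (S ∷ P) u = Unique-++⁻ˡ u ∷ Unique-concat⁻ P (Unique-++⁻ʳ S u)

      AllPairs-map-with : ∀ {B : Set} {Q : A → Set} {R : A → A → Set} {R′ : B → B → Set} (f : A → B) →
        (∀ {a b} → Q a → Q b → R a b → R′ (f a) (f b)) →
        ∀ {xs} → All Q xs → AllPairs R xs → AllPairs R′ (map f xs)
      AllPairs-map-with f pres [] [] = []
      AllPairs-map-with f pres (Qx ∷ Qxs) (Rx ∷ Rxs) =
        All.map⁺ (All.zipWith (λ (Qy , Rxy) → pres Qx Qy Rxy) (Qxs , Rx)) ∷ AllPairs-map-with f pres Qxs Rxs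

  filter-∈-sublists : ∀ (S : List ℕ) xs → filter (_∈? S) xs ∈ sublists xs
  filter-∈-sublists S [] = here refl
  filter-∈-sublists S (x ∷ xs) with x ∈? S
  ... | yes _ = ∈-++⁺ˡ (∈-map⁺ (x ∷_) (filter-∈-sublists S xs))
  ... | no _ = ∈-++⁺ʳ (map (x ∷_) (sublists xs)) (filter-∈-sublists S xs)

  ValidBlock-resp-≐ : ∀ {S S′} → S ⊆ S′ → S′ ⊆ S → ValidBlock S → ValidBlock S′
  ValidBlock-resp-≐ {[]} _ _ ([]≢[] , _) = ⊥-elim ([]≢[] refl)
  ValidBlock-resp-≐ {x ∷ S} {S′} S⊆S′ S′⊆S (_ , refines , agrees) = S′≢[] , refines′ refines , agrees′
    where
    S′≢[] : S′ ≢ []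
    S′≢[] refl with S⊆S′ (here refl)
    ... | ()
    refines′ : Refines (x ∷ S) → Refines S′
    refines′ (inj₁ ⊆A) = inj₁ (λ y∈ → ⊆A (S′⊆S y∈))
    refines′ (inj₂ (inj₁ ⊆B)) = inj₂ (inj₁ (λ y∈ → ⊆B (S′⊆S y∈)))
    refines′ (inj₂ (inj₂ ⊆C)) = inj₂ (inj₂ (λ y∈ → ⊆C (S′⊆S y∈)))
    agrees′ : Agrees S′
    agrees′ D c S′⊆D rewrite sym (restrict-cong S⊆S′ S′⊆S T) | sym (restrict-cong S⊆S′ S′⊆S D) =
      agrees D c (λ y∈ → S′⊆D (S⊆S′ y∈))

  Separated-resp-≐ : ∀ {S S′ K K′} → S ⊆ S′ → S′ ⊆ S → K ⊆ K′ → K′ ⊆ K → Separated S K → Separated S′ K′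
  Separated-resp-≐ S⊆S′ S′⊆S K⊆K′ K′⊆K (inT , inF) =
    (λ r i j → inT r (InSpan-mono S′⊆S i) (InSpan-mono K′⊆K j)) ,
    (λ D c S′⊆D K′⊆D r i j →
       inF D c (λ y∈ → S′⊆D (S⊆S′ y∈)) (λ y∈ → K′⊆D (K⊆K′ y∈)) r (InSpan-mono S′⊆S i) (InSpan-mono K′⊆K j))

  canonical : List ℕ → List ℕ
  canonical S = filter (_∈? S) (leaves T)

  canonical-⊆ : ∀ {S} → canonical S ⊆ S
  canonical-⊆ {S} x∈ = proj₂ (∈-filter⁻ (_∈? S) {xs = leaves T} x∈)

  ⊆-canonical : ∀ {S} → S ⊆ leaves T → S ⊆ canonical S
  ⊆-canonical S⊆L x∈S = ∈-filter⁺ (_∈? _) (S⊆L x∈S) x∈S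

  AgreementForest-canonical : ∀ {P} → AgreementForest P → AgreementForest (map canonical P)
  AgreementForest-canonical {P} (mkAF valid partition separated) = mkAF
    (All.map⁺ (All.zipWith canonical-valid (blocks⊆L , valid)))
    (↭-trans (concat-↭-pointwise (All.zipWith canonical↭
               (blocks⊆L , Unique-concat⁻ P (Unique-resp-↭ (↭-sym partition) phT))))
             partition)
    (AllPairs-map-with canonical canonical-separated blocks⊆L separated)
    where
    blocks⊆L : All (_⊆ leaves T) P
    blocks⊆L = All.tabulate (λ S∈P x∈S → ∈-resp-↭ partition (∈-concat⁺′ x∈S S∈P))
    canonical-valid : ∀ {S} → S ⊆ leaves T × ValidBlock S → ValidBlock (canonical S)
    canonical-valid (S⊆L , v) = ValidBlock-resp-≐ (⊆-canonical S⊆L) canonical-⊆ v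
    canonical-separated : ∀ {S K} → S ⊆ leaves T → K ⊆ leaves T →
      Separated S K → Separated (canonical S) (canonical K)
    canonical-separated S⊆L K⊆L =
      Separated-resp-≐ (⊆-canonical S⊆L) canonical-⊆ (⊆-canonical K⊆L) canonical-⊆
    canonical↭ : ∀ {S} → S ⊆ leaves T × Unique S → canonical S ↭ S
    canonical↭ (S⊆L , uniqueS) =
      ↭-unique-set (Unique.filter⁺ (_∈? _) phT) uniqueS canonical-⊆ (⊆-canonical S⊆L)
    concat-↭-pointwise : ∀ {Q} → All (λ S → canonical S ↭ S) Q → concat (map canonical Q) ↭ concat Q
    concat-↭-pointwise [] = ↭-refl
    concat-↭-pointwise (S↭ ∷ Q↭) = ++⁺ S↭ (concat-↭-pointwise Q↭)

  candidates : List (List (List ℕ))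
  candidates = listsUpTo (length (leaves T)) (sublists (leaves T))

  canonical-∈-candidates : ∀ {P} → AgreementForest P → map canonical P ∈ candidates
  canonical-∈-candidates {P} (mkAF valid partition _) =
    ∈-listsUpTo (length (leaves T)) (sublists (leaves T)) (map canonical P)
    (subst (_≤ length (leaves T)) (sym (length-map canonical P))
      (≤-trans (length≤length-concat P (All.map proj₁ valid)) (≤-reflexive (↭-length partition))))
    (All.map⁺ (All.tabulate (λ {S} _ → filter-∈-sublists S (leaves T))))

  private
    IsComponent⇒Phylo : ∀ {D} → IsComponent D → Phylo D
    IsComponent⇒Phylo (inj₁ refl) = phA
    IsComponent⇒Phylo (inj₂ (inj₁ refl)) = phB
    IsComponent⇒Phylo (inj₂ (inj₂ refl)) = phC

    concat-singletons : ∀ (xs : List ℕ) → concat (map [_] xs) ≡ xs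
    concat-singletons [] = refl
    concat-singletons (x ∷ xs) = cong (x ∷_) (concat-singletons xs)

    SpanDisjoint-singletons : ∀ {t x y} → Phylo t → x ≢ y → SpanDisjoint t [ x ] [ y ]
    SpanDisjoint-singletons {t} ph x≢y r i j =
      x≢y (LeafAt-functional {t} {r} (InSpan-singleton ph i) (InSpan-singleton ph j))

    singleton-valid : ∀ {x} → x ∈ leaves T → ValidBlock [ x ]
    singleton-valid {x} x∈L = (λ ()) , refines , agrees
      where
      refines : Refines [ x ]
      refines with ∈-++⁻ (leaves tA) (∈-resp-↭ (↭-sym partition) x∈L)
      ... | inj₁ x∈A = inj₁ (λ { (here refl) → x∈A })
      ... | inj₂ x∈BC with ∈-++⁻ (leaves tB) x∈BC
      ...   | inj₁ x∈B = inj₂ (inj₁ (λ { (here refl) → x∈B }))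
      ...   | inj₂ x∈C = inj₂ (inj₂ (λ { (here refl) → x∈C }))
      agrees : Agrees [ x ]
      agrees D c x∈D = ≡⇒≃ (trans (restrict-singleton T phT x∈L)
                           (sym (restrict-singleton D (IsComponent⇒Phylo c) (x∈D (here refl)))))

  singletons : AgreementForest (map [_] (leaves T))
  singletons = mkAF
    (All.map⁺ (All.tabulate singleton-valid))
    (↭-reflexive (concat-singletons (leaves T)))
    (AllPairs.map⁺ (AllPairs.map separated phT))
    where
    separated : ∀ {x y} → x ≢ y → Separated [ x ] [ y ]
    separated x≢y = SpanDisjoint-singletons phT x≢y , λ D c _ _ → SpanDisjoint-singletons (IsComponent⇒Phylo c) x≢y

  -- Every agreement forest has a canonical copy of the same size among the
  -- finitely many candidates, so a minimum exists constructively.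
  minimum-exists : ∃ λ P → AgreementForest P × (∀ Q → ReachableAF T tA tB tC Q → length P ≤ length Q)
  minimum-exists with ∃-minimal length (AgreementForest? phT) candidates
    (_ , canonical-∈-candidates singletons , AgreementForest-canonical singletons)
  ... | P , _ , af , minimal = P , af , λ Q reachable →
    let afQ = Reachable⇒AgreementForest reachable in
    subst (length P ≤_) (length-map canonical Q)
      (minimal (canonical-∈-candidates afQ) (AgreementForest-canonical afQ))

module Components (T tA tB tC : Tree) (phT : Phylo T)
  (partition : (leaves tA ++ leaves tB ++ leaves tC) ↭ leaves T) where
  open Leaves
  open Spans
  open Restriction
  open SpanMembership
  open Forests T tA tB tC
  open import Data.Nat using (ℕ)
  open import Data.List using (List)
  open import Data.List.Membership.Propositional using (_∈_)
  open import Data.List.Membership.Propositional.Properties using (∈-++⁺ˡ; ∈-++⁺ʳ)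
  open import Data.List.Relation.Binary.Subset.Propositional using (_⊆_)
  open import Data.List.Relation.Binary.Permutation.Propositional using (↭-sym)
  open import Data.List.Relation.Binary.Permutation.Propositional.Properties using (∈-resp-↭)
  open import Data.List.Relation.Unary.Unique.Propositional using (Unique)
  open import Data.Sum using (inj₁; inj₂)
  open import Data.Product using (∃; _×_; _,_)
  open import Data.Empty using (⊥; ⊥-elim)
  open import Relation.Binary.PropositionalEquality using (_≡_; refl)
  open import Function using (case_of_)

  A B C : List ℕ
  A = leaves tA
  B = leaves tB
  C = leaves tC

  private
    unique-ABC : Unique (A ++ B ++ C)
    unique-ABC = Unique-resp-↭ (↭-sym partition) phT

  A∩B=∅ : ∀ {x} → x ∈ A → x ∈ B → ⊥
  A∩B=∅ x∈A x∈B = Unique-++⇒disjoint unique-ABC x∈A (∈-++⁺ˡ x∈B)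

  A∩C=∅ : ∀ {x} → x ∈ A → x ∈ C → ⊥
  A∩C=∅ x∈A x∈C = Unique-++⇒disjoint unique-ABC x∈A (∈-++⁺ʳ B x∈C)

  B∩C=∅ : ∀ {x} → x ∈ B → x ∈ C → ⊥
  B∩C=∅ x∈B x∈C = Unique-++⇒disjoint (Unique-++⁻ʳ A unique-ABC) x∈B x∈C

  A⊆L : A ⊆ leaves T
  A⊆L x∈A = ∈-resp-↭ partition (∈-++⁺ˡ x∈A)

  B⊆L : B ⊆ leaves T
  B⊆L x∈B = ∈-resp-↭ partition (∈-++⁺ʳ A (∈-++⁺ˡ x∈B))

  component-A : ∀ {D x} → IsComponent D → x ∈ leaves D → x ∈ A → D ≡ tA
  component-A (inj₁ refl) _ _ = refl
  component-A (inj₂ (inj₁ refl)) x∈B x∈A = ⊥-elim (A∩B=∅ x∈A x∈B)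
  component-A (inj₂ (inj₂ refl)) x∈C x∈A = ⊥-elim (A∩C=∅ x∈A x∈C)

  component-B : ∀ {D x} → IsComponent D → x ∈ leaves D → x ∈ B → D ≡ tB
  component-B (inj₁ refl) x∈A x∈B = ⊥-elim (A∩B=∅ x∈A x∈B)
  component-B (inj₂ (inj₁ refl)) _ _ = refl
  component-B (inj₂ (inj₂ refl)) x∈C x∈B = ⊥-elim (B∩C=∅ x∈B x∈C)

  component-C : ∀ {D x} → IsComponent D → x ∈ leaves D → x ∈ C → D ≡ tC
  component-C (inj₁ refl) x∈A x∈C = ⊥-elim (A∩C=∅ x∈A x∈C)
  component-C (inj₂ (inj₁ refl)) x∈B x∈C = ⊥-elim (B∩C=∅ x∈B x∈C)
  component-C (inj₂ (inj₂ refl)) _ _ = refl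

  same-component : ∀ {D D′ x} → IsComponent D → IsComponent D′ → x ∈ leaves D → x ∈ leaves D′ → D′ ≡ D
  same-component (inj₁ refl) c′ x∈A x∈D′ = component-A c′ x∈D′ x∈A
  same-component (inj₂ (inj₁ refl)) c′ x∈B x∈D′ = component-B c′ x∈D′ x∈B
  same-component (inj₂ (inj₂ refl)) c′ x∈C x∈D′ = component-C c′ x∈D′ x∈C

  Refines⇒component : ∀ {S} → Refines S → ∃ λ D → IsComponent D × S ⊆ leaves D
  Refines⇒component (inj₁ S⊆A) = tA , inj₁ refl , S⊆A
  Refines⇒component (inj₂ (inj₁ S⊆B)) = tB , inj₂ (inj₁ refl) , S⊆B
  Refines⇒component (inj₂ (inj₂ S⊆C)) = tC , inj₂ (inj₂ refl) , S⊆C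

  Refines-A : ∀ {K x} → Refines K → x ∈ K → x ∈ A → K ⊆ A
  Refines-A (inj₁ K⊆A) _ _ = K⊆A
  Refines-A (inj₂ (inj₁ K⊆B)) x∈K x∈A = ⊥-elim (A∩B=∅ x∈A (K⊆B x∈K))
  Refines-A (inj₂ (inj₂ K⊆C)) x∈K x∈A = ⊥-elim (A∩C=∅ x∈A (K⊆C x∈K))

  Refines-B : ∀ {K x} → Refines K → x ∈ K → x ∈ B → K ⊆ B
  Refines-B (inj₁ K⊆A) x∈K x∈B = ⊥-elim (A∩B=∅ (K⊆A x∈K) x∈B)
  Refines-B (inj₂ (inj₁ K⊆B)) _ _ = K⊆B
  Refines-B (inj₂ (inj₂ K⊆C)) x∈K x∈B = ⊥-elim (B∩C=∅ x∈B (K⊆C x∈K))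


  -- Through the common taxon x, a component containing X contains S ⊇ X.
  module _ {S X x} (X⊆S : X ⊆ S) (x∈X : x ∈ X) (refines : Refines S) where

    private
      component-of : ∀ {D} → IsComponent D → X ⊆ leaves D → S ⊆ leaves D
      component-of {D} c X⊆D with Refines⇒component refines
      ... | D′ , c′ , S⊆D′ with same-component c c′ (X⊆D x∈X) (S⊆D′ (X⊆S x∈X))
      ...   | refl = S⊆D′

    ValidBlock-⊆ : Agrees S → ValidBlock X
    ValidBlock-⊆ agrees = (λ { refl → case x∈X of λ () }) , refines-X refines ,
      λ D c X⊆D → restrict-agree-⊆ {t = T} {D} X⊆S (agrees D c (component-of c X⊆D))
      where
      refines-X : Refines S → Refines X
      refines-X (inj₁ S⊆A) = inj₁ (λ y∈ → S⊆A (X⊆S y∈))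
      refines-X (inj₂ (inj₁ S⊆B)) = inj₂ (inj₁ (λ y∈ → S⊆B (X⊆S y∈)))
      refines-X (inj₂ (inj₂ S⊆C)) = inj₂ (inj₂ (λ y∈ → S⊆C (X⊆S y∈)))

    Separated-⊆ : ∀ {K} → Separated S K → Separated X K
    Separated-⊆ (inT , inF) = (λ r i j → inT r (InSpan-mono X⊆S i) j) ,
      λ D c X⊆D K⊆D r i j → inF D c (component-of c X⊆D) K⊆D r (InSpan-mono X⊆S i) j

    Separated-within : ∀ {X′} → X′ ⊆ S → Agrees S → SpanDisjoint T X X′ → Separated X X′
    Separated-within X′⊆S agrees disjT = disjT ,
      λ D c X⊆D X′⊆D → SpanDisjoint-transfer {T} {D} X⊆S X′⊆S (agrees D c (component-of c X⊆D)) disjT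

module SharedEdge (T tA tB tC : Tree) (phT : Phylo T)
  (partition : (leaves tA ++ leaves tB ++ leaves tC) ↭ leaves T)
  (u : Pos) (b : Bool)
  (e∈A : EdgeInSpan T (leaves tA) (u , b)) (e∈B : EdgeInSpan T (leaves tB) (u , b))
  (e-unique : ∀ e′ → EdgeInSpan T (leaves tA) e′ → EdgeInSpan T (leaves tB) e′ → e′ ≡ (u , b)) where
  open Paths
  open Leaves
  open Spans
  open Forests T tA tB tC using (IsComponent; Refines)
  open Components T tA tB tC phT partition
  open import Data.Nat using (ℕ)
  open import Data.Nat.Properties using (_≟_)
  open import Data.List.Membership.DecPropositional _≟_ using (_∈?_)
  open import Data.Bool using (not)
  open import Data.Bool.Properties using (not-¬)
  open import Data.List using (List; []; [_]; _∷ʳ_; initLast; _∷ʳ′_)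
  open import Data.List.Membership.Propositional using (_∈_; find; lose)
  open import Data.List.Relation.Unary.Any using (Any; any?)
  open import Data.List.Relation.Binary.Subset.Propositional using (_⊆_)
  open import Data.Product using (∃; _×_; proj₁; proj₂)
  open import Data.Product.Properties using (,-injectiveˡ; ,-injectiveʳ)
  open import Data.Sum using (_⊎_; inj₁; inj₂)
  open import Data.Empty using (⊥; ⊥-elim)
  open import Relation.Nullary using (¬_; yes; no)
  open import Relation.Unary using (Decidable)
  open import Relation.Unary.Properties using (∁?)
  open import Relation.Nullary.Decidable using (map′; _×-dec_)
  open import Relation.Binary.PropositionalEquality using (_≢_; refl; sym; trans; cong; subst)

  v : Pos
  v = u ++ [ b ]

  Lower : ℕ → Set
  Lower = Below T (u , b)

  Lower⇒v⊑ : ∀ {x q} → Lower x → LeafAt T q x → v ⊑ q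
  Lower⇒v⊑ {x} {q} (q′ , lx′ , v⊑q′) lx with LeafAt-injective {T} {q′} {q} phT lx′ lx
  ... | refl = v⊑q′

  Lower? : Decidable Lower
  Lower? x with x ∈? leaves T
  ... | no x∉L = no (λ (q , lx , _) → x∉L (LeafAt⇒∈ {T} {q} lx))
  ... | yes x∈L with ∈⇒LeafAt {T} x∈L
  ...   | q , lx with v ⊑? q
  ...     | yes v⊑q = yes (q , lx , v⊑q)
  ...     | no v⋢q = no (λ lower → v⋢q (Lower⇒v⊑ lower lx))

  record LeafWith (S : List ℕ) (Q : Pos → Set) : Set where
    constructor leafWith
    field
      taxon  : ℕ
      pos    : Pos
      taxon∈ : taxon ∈ S
      leafAt : LeafAt T pos taxon
      holds  : Q pos

  a₁ : LeafWith A (v ⊑_)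
  a₁ with InSpan⇒Above (proj₂ e∈A)
  ... | x , p , x∈A , lx , v⊑p = leafWith x p x∈A lx v⊑p

  a₂ : LeafWith A (λ p → ¬ v ⊑ p)
  a₂ with proj₁ e∈A
  ... | x , y , p , q , x∈A , y∈A , lx , ly , (_ , l⊑u) with v ⊑? p | v ⊑? q
  ...   | no v⋢p | _ = leafWith x p x∈A lx v⋢p
  ...   | yes _ | no v⋢q = leafWith y q y∈A ly v⋢q
  ...   | yes v⊑p | yes v⊑q = ⊥-elim (step⋢ (⊑-trans (⊑-lcp v⊑p v⊑q) l⊑u))

  module a₁ = LeafWith a₁
  module a₂ = LeafWith a₂

  v≢u : v ≢ u
  v≢u v≡u = step⋢ (subst (v ⊑_) v≡u ⊑-refl)

  no-leaf-at-u : ∀ {z} → ¬ LeafAt T u z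
  no-leaf-at-u lu = step⋢ (subst (v ⊑_) (LeafAt-maximal lu (step⊑⇒⊑ a₁.holds) a₁.leafAt) a₁.holds)

  leaf-at-v : ∀ {z} → LeafAt T v z → z ≡ a₁.taxon
  leaf-at-v {z} lv = LeafAt-functional {T} {v} lv
    (subst (λ w → LeafAt T w a₁.taxon) (LeafAt-maximal lv a₁.holds a₁.leafAt) a₁.leafAt)

  private
    shared-edge : ∀ {p c} → EdgeInSpan T A (p , c) → EdgeInSpan T B (p , c) → p ≡ u × c ≡ b
    shared-edge {p} {c} eA eB = ,-injectiveˡ (e-unique (p , c) eA eB) , ,-injectiveʳ (e-unique (p , c) eA eB)

  -- For r ≠ u in both spans, the edge leaving r towards u lies in both spans by
  -- convexity, so it is e, and then r = v.
  InSpan-A∩B : ∀ {r} → InSpan T A r → InSpan T B r → r ≡ u ⊎ r ≡ v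
  InSpan-A∩B {r} r∈A r∈B with r ≟ₚ u | r ⊑? u
  ... | yes r≡u | _ = inj₁ r≡u
  ... | no r≢u | yes r⊑u with ⊑-step r⊑u r≢u
  ...   | c , rc⊑u = ⊥-elim (r≢u (proj₁ (shared-edge (r∈A , InSpan-convex r∈A (proj₁ e∈A) toward-u)
                                                     (r∈B , InSpan-convex r∈B (proj₁ e∈B) toward-u))))
    where
    toward-u : OnPath r u (r ++ [ c ])
    toward-u = inj₂ rc⊑u , subst (_⊑ (r ++ [ c ])) (trans (sym (⊑⇒lcp≡ r⊑u)) (lcp-comm u r)) (⊑-++ r [ c ])
  InSpan-A∩B {r} r∈A r∈B | no r≢u | no r⋢u with initLast r
  ... | [] = ⊥-elim (r⋢u []⊑)
  ... | r₀ ∷ʳ′ c with shared-edge (InSpan-convex r∈A (proj₁ e∈A) toward-parent , r∈A)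
                                  (InSpan-convex r∈B (proj₁ e∈B) toward-parent , r∈B)
    where
    toward-parent : OnPath (r₀ ∷ʳ c) u r₀
    toward-parent = inj₁ (⊑-++ r₀ [ c ]) ,
      ⊑-step⁻ (lcp-⊑ˡ (r₀ ∷ʳ c) u) (λ l≡r → r⋢u (subst (_⊑ u) l≡r (lcp-⊑ʳ (r₀ ∷ʳ c) u)))
  ...   | refl , refl = inj₂ refl

  Crossing : List ℕ → Set
  Crossing S = ∃ λ x → ∃ λ y → x ∈ S × y ∈ S × x ∈ B × Lower x × y ∈ B × ¬ Lower y

  Crossing⇒EdgeInSpan : ∀ {S} → Crossing S → EdgeInSpan T S (u , b)
  Crossing⇒EdgeInSpan (x , y , x∈S , y∈S , _ , (px , lx , v⊑px) , y∈B , ¬lower-y) =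
    let (py , ly) = ∈⇒LeafAt {T} (B⊆L y∈B) in
    EdgeInSpan-separating {T} x∈S lx v⊑px y∈S ly (λ v⊑py → ¬lower-y (py , ly , v⊑py))

  Crossing⇒⊆B : ∀ {S} → Refines S → Crossing S → S ⊆ B
  Crossing⇒⊆B refines (_ , _ , x∈S , _ , x∈B , _) = Refines-B refines x∈S x∈B

  private
    -- a₁ lies below v ++ [ c ] and a₂ does not, so the edge into v ++ [ c ] is in T[A]
    v-child-edge-not-in-B : ∀ {c X x y px py} → (v ++ [ c ]) ⊑ a₁.pos → X ⊆ B →
      x ∈ X → LeafAt T px x → (v ++ [ c ]) ⊑ px → y ∈ X → LeafAt T py y → ¬ ((v ++ [ c ]) ⊑ py) → ⊥
    v-child-edge-not-in-B vc⊑a₁ X⊆B x∈X lx vc⊑px y∈X ly vc⋢py =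
      v≢u (proj₁ (shared-edge e∈A′ e∈B′))
      where
      e∈A′ : EdgeInSpan T A (v , _)
      e∈A′ = EdgeInSpan-separating {T} a₁.taxon∈ a₁.leafAt vc⊑a₁ a₂.taxon∈ a₂.leafAt
               (λ vc⊑a₂ → a₂.holds (step⊑⇒⊑ vc⊑a₂))
      e∈B′ : EdgeInSpan T B (v , _)
      e∈B′ = EdgeInSpan-separating {T} (X⊆B x∈X) lx vc⊑px (X⊆B y∈X) ly vc⋢py

  InSpan-lower⇒v∉ : ∀ {X} → X ⊆ B → (∀ {x} → x ∈ X → Lower x) → ¬ InSpan T X v
  InSpan-lower⇒v∉ {X} X⊆B lower (x , y , px , py , x∈X , y∈X , lx , ly , (_ , l⊑v))
    with px ≟ₚ v | py ≟ₚ v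
  ... | yes refl | _ = A∩B=∅ (subst (_∈ A) (sym (leaf-at-v lx)) a₁.taxon∈) (X⊆B x∈X)
  ... | no _ | yes refl = A∩B=∅ (subst (_∈ A) (sym (leaf-at-v ly)) a₁.taxon∈) (X⊆B y∈X)
  ... | no px≢v | no py≢v with ⊑-step a₁.holds v≢a₁
    where
    v≢a₁ : v ≢ a₁.pos
    v≢a₁ v≡a₁ = px≢v (LeafAt-maximal (subst (λ w → LeafAt T w a₁.taxon) (sym v≡a₁) a₁.leafAt)
                                       (Lower⇒v⊑ (lower x∈X) lx) lx)
  ...   | c , vc⊑a₁ with (v ++ [ c ]) ⊑? px | (v ++ [ c ]) ⊑? py
  ...     | yes vc⊑px | yes vc⊑py = step⊑-both⇒lcp⋢ vc⊑px vc⊑py l⊑v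
  ...     | yes vc⊑px | no vc⋢py = v-child-edge-not-in-B vc⊑a₁ X⊆B x∈X lx vc⊑px y∈X ly vc⋢py
  ...     | no vc⋢px | yes vc⊑py = v-child-edge-not-in-B vc⊑a₁ X⊆B y∈X ly vc⊑py x∈X lx vc⋢px
  ...     | no vc⋢px | no vc⋢py = step⊑-both⇒lcp⋢
            (⊑-step-other (Lower⇒v⊑ (lower x∈X) lx) (λ v≡px → px≢v (sym v≡px)) vc⋢px)
            (⊑-step-other (Lower⇒v⊑ (lower y∈X) ly) (λ v≡py → py≢v (sym v≡py)) vc⋢py) l⊑v

  private
    other-child : ∀ {z pz} → ¬ Lower z → LeafAt T pz z → u ⊑ pz → (u ++ [ not b ]) ⊑ pz
    other-child upper-z lz u⊑pz = ⊑-step-other u⊑pz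
      (λ u≡pz → no-leaf-at-u (subst (λ w → LeafAt T w _) (sym u≡pz) lz))
      (λ v⊑pz → upper-z (_ , lz , v⊑pz))

    upper-u∉ : ∀ {X x y px py} → X ⊆ B → (∀ {x} → x ∈ X → ¬ Lower x) →
      x ∈ X → LeafAt T px x → y ∈ X → LeafAt T py y → u ⊑ px → lcp px py ⊑ u → ⊥
    upper-u∉ {px = px} {py} X⊆B upper x∈X lx y∈X ly u⊑px l⊑u with u ⊑? py
    ... | yes u⊑py = step⊑-both⇒lcp⋢ (other-child (upper x∈X) lx u⊑px) (other-child (upper y∈X) ly u⊑py) l⊑u
    ... | no u⋢py with u ⊑? a₂.pos
    ...   | yes u⊑a₂ = not-¬ refl (sym (proj₂ (shared-edge e∈A′ e∈B′)))
      where
      e∈A′ : EdgeInSpan T A (u , not b)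
      e∈A′ = EdgeInSpan-separating {T} a₂.taxon∈ a₂.leafAt
        (⊑-step-other u⊑a₂ (λ u≡a₂ → no-leaf-at-u (subst (λ w → LeafAt T w a₂.taxon) (sym u≡a₂) a₂.leafAt))
                      (λ v⊑a₂ → a₂.holds v⊑a₂))
        a₁.taxon∈ a₁.leafAt (λ u¬b⊑a₁ → not-¬ refl (step⊑-unique {u} a₁.holds u¬b⊑a₁))
      e∈B′ : EdgeInSpan T B (u , not b)
      e∈B′ = EdgeInSpan-separating {T} (X⊆B x∈X) lx (other-child (upper x∈X) lx u⊑px)
                                       (X⊆B y∈X) ly (λ u¬b⊑py → u⋢py (step⊑⇒⊑ u¬b⊑py))
    ...   | no u⋢a₂ with ≢[]⇒step (λ u≡[] → u⋢a₂ (subst (_⊑ a₂.pos) (sym u≡[]) []⊑))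
    ...     | u₀ , d , u≡u₀d = step⋢ (subst (_⊑ u) (cong (_++ [ d ]) (proj₁ (shared-edge e∈A′ e∈B′))) u₀d⊑u)
      where
      u₀d⊑u : (u₀ ++ [ d ]) ⊑ u
      u₀d⊑u = subst (_⊑ u) u≡u₀d ⊑-refl
      u⊑u₀d : u ⊑ (u₀ ++ [ d ])
      u⊑u₀d = subst (u ⊑_) u≡u₀d ⊑-refl
      e∈A′ : EdgeInSpan T A (u₀ , d)
      e∈A′ = EdgeInSpan-separating {T} a₁.taxon∈ a₁.leafAt (subst (_⊑ a₁.pos) u≡u₀d (step⊑⇒⊑ a₁.holds))
                                       a₂.taxon∈ a₂.leafAt (λ u₀d⊑a₂ → u⋢a₂ (⊑-trans u⊑u₀d u₀d⊑a₂))
      e∈B′ : EdgeInSpan T B (u₀ , d)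
      e∈B′ = EdgeInSpan-separating {T} (X⊆B x∈X) lx (subst (_⊑ px) u≡u₀d u⊑px)
                                       (X⊆B y∈X) ly (λ u₀d⊑py → u⋢py (⊑-trans u⊑u₀d u₀d⊑py))

  InSpan-upper⇒u∉ : ∀ {X} → X ⊆ B → (∀ {x} → x ∈ X → ¬ Lower x) → ¬ InSpan T X u
  InSpan-upper⇒u∉ X⊆B upper (_ , _ , px , py , x∈X , y∈X , lx , ly , (inj₁ u⊑px , l⊑u)) =
    upper-u∉ X⊆B upper x∈X lx y∈X ly u⊑px l⊑u
  InSpan-upper⇒u∉ X⊆B upper (_ , _ , px , py , x∈X , y∈X , lx , ly , (inj₂ u⊑py , l⊑u)) =
    upper-u∉ X⊆B upper y∈X ly x∈X lx u⊑py (subst (_⊑ u) (lcp-comm px py) l⊑u)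

  span∌v⇒lower-closed : ∀ {K x y q} → ¬ InSpan T K v → x ∈ K → Lower x → y ∈ K → LeafAt T q y → v ⊑ q
  span∌v⇒lower-closed {q = q} v∉K x∈K (px , lx , v⊑px) y∈K ly with v ⊑? q
  ... | yes v⊑q = v⊑q
  ... | no v⋢q = ⊥-elim (v∉K (proj₂ (EdgeInSpan-separating {T} x∈K lx v⊑px y∈K ly v⋢q)))

  Crossing? : Decidable Crossing
  Crossing? S = map′ to from
    (any? (λ x → (x ∈? B) ×-dec Lower? x) S ×-dec any? (λ y → (y ∈? B) ×-dec ∁? Lower? y) S)
    where
    to : Any (λ x → x ∈ B × Lower x) S × Any (λ y → y ∈ B × ¬ Lower y) S → Crossing S
    to (lower , upper) with find lower | find upper
    ... | x , x∈S , x∈B , lower-x | y , y∈S , y∈B , upper-y = x , y , x∈S , y∈S , x∈B , lower-x , y∈B , upper-y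
    from : Crossing S → Any (λ x → x ∈ B × Lower x) S × Any (λ y → y ∈ B × ¬ Lower y) S
    from (x , y , x∈S , y∈S , x∈B , lower-x , y∈B , upper-y) = lose x∈S (x∈B , lower-x) , lose y∈S (y∈B , upper-y)

module Exchange (T tA tB tC : Tree) (phT : Phylo T)
  (partition : (leaves tA ++ leaves tB ++ leaves tC) ↭ leaves T)
  (agree-A : restrict (leaves tA) T ≃ restrict (leaves tA) tA)
  (C#A : SpanDisjoint T (leaves tC) (leaves tA))
  (u : Pos) (b : Bool)
  (e∈A : EdgeInSpan T (leaves tA) (u , b)) (e∈B : EdgeInSpan T (leaves tB) (u , b))
  (e-unique : ∀ e′ → EdgeInSpan T (leaves tA) e′ → EdgeInSpan T (leaves tB) e′ → e′ ≡ (u , b)) where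
  open Paths
  open Leaves
  open Spans
  open Restriction
  open SpanMembership
  open Minimisation
  open Forests T tA tB tC
  open Components T tA tB tC phT partition
  open SharedEdge T tA tB tC phT partition u b e∈A e∈B e-unique
  open import Data.Nat using (ℕ; _≤_)
  open import Data.Nat.Properties using (_≟_; <⇒≱)
  open import Data.List using (List; _∷_; length; concat; filter; cartesianProduct)
  open import Data.List.Properties using (partition-defn; ++-assoc)
  open import Data.List.Membership.Propositional using (_∈_; find; lose)
  open import Data.List.Membership.Propositional.Properties
    using (∈-∃++; ∈-++⁻; ∈-++⁺ˡ; ∈-concat⁻′; ∈-filter⁺; ∈-filter⁻; ∈-cartesianProduct⁺; ∈-cartesianProduct⁻)
  open import Data.List.Relation.Binary.Subset.Propositional using (_⊆_)
  open import Data.List.Relation.Binary.Subset.DecPropositional _≟_ using (_⊆?_)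
  open import Data.List.Relation.Binary.Permutation.Propositional
    using (↭-sym; ↭-trans; prep; ↭ₛ⇒↭; module PermutationReasoning)
  open import Data.List.Relation.Binary.Permutation.Propositional.Properties
    using (∈-resp-↭; shift; ++⁺ʳ; ↭-length)
  open import Data.List.Relation.Unary.All.Properties using (¬Any⇒All¬)
  import Data.List.Relation.Binary.Permutation.Setoid.Properties as Permutationₛ
  open import Data.List.Relation.Unary.All as All using (All; _∷_)
  open import Data.List.Relation.Unary.AllPairs as AllPairs using (AllPairs; _∷_)
  open import Data.List.Relation.Unary.Any using (Any; here; there; any?)
  open import Data.Product using (∃; _×_; proj₁; proj₂)
  open import Data.Sum using (_⊎_; inj₁; inj₂)
  open import Data.Empty using (⊥; ⊥-elim)
  open import Function using (_∘_; case_of_)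
  open import Relation.Nullary using (¬_; yes; no)
  open import Relation.Nullary.Decidable using (_×-dec_; decidable-stable)
  open import Relation.Unary using (Decidable; ∁)
  open import Relation.Unary.Properties using (∁?)
  open import Relation.Binary.PropositionalEquality using (_≢_; refl; sym; trans; cong; subst; setoid)

  record Closest (Side : ℕ → Set) (R : List (List ℕ)) (K : List ℕ) : Set where
    field
      ⊆A      : K ⊆ A
      witness : Any Side K
      vertex  : Pos
      vertex∈ : InSpan T K vertex
      closest : ∀ {K′ r} → K′ ∈ R → K′ ⊆ A → Any Side K′ → InSpan T K′ r →
                offsetDist u vertex ≤ offsetDist u r

  Closest-⊆ : ∀ {Side R R′ K} → R ⊆ R′ → Closest Side R′ K → Closest Side R K
  Closest-⊆ R⊆R′ c = record
    { ⊆A = ⊆A ; witness = witness ; vertex = vertex ; vertex∈ = vertex∈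
    ; closest = λ K′∈R → closest (R⊆R′ K′∈R) }
    where open Closest c

  closest-exists : ∀ {Side} → Decidable Side → ∀ R → (∃ λ K → K ∈ R × K ⊆ A × Any Side K) →
    ∃ λ K → K ∈ R × Closest Side R K
  closest-exists {Side} Side? R (K , K∈R , K⊆A , side) with find side
  ... | a , a∈K , _ with ∈⇒LeafAt {T} (A⊆L (K⊆A a∈K))
  ...   | pa , la with ∃-minimal (offsetDist u ∘ proj₂) Candidate? (cartesianProduct R (positions T))
                       ((K , pa) , ∈-cartesianProduct⁺ K∈R (InSpan⇒∈positions (InSpan-leaf {T} a∈K la)) ,
                        K⊆A , side , InSpan-leaf {T} a∈K la)
    where
    Candidate : List ℕ × Pos → Set
    Candidate (K′ , h) = K′ ⊆ A × Any Side K′ × InSpan T K′ h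
    Candidate? : Decidable Candidate
    Candidate? (K′ , h) = (K′ ⊆? A) ×-dec (any? Side? K′ ×-dec InSpan? T K′ h)
  ...     | (K₀ , h) , mem , (K₀⊆A , w , h∈) , minimal =
    K₀ , proj₁ (∈-cartesianProduct⁻ R (positions T) mem) , record
      { ⊆A = K₀⊆A ; witness = w ; vertex = h ; vertex∈ = h∈
      ; closest = λ K′∈R K′⊆A w′ r∈ →
          minimal (∈-cartesianProduct⁺ K′∈R (InSpan⇒∈positions r∈)) (K′⊆A , w′ , r∈) }

  ∈⇒↭∷ : ∀ {X : Set} {x : X} {xs} → x ∈ xs → ∃ λ ys → xs ↭ x ∷ ys
  ∈⇒↭∷ {x = x} x∈xs with ∈-∃++ x∈xs
  ... | ys , zs , refl = ys ++ zs , shift x ys zs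

  module _ {S R₀} (af : AgreementForest (S ∷ R₀)) (crossing : Crossing S) where

    private
      open AgreementForest af renaming (partition to blocks↭L)

      S-separated : ∀ {K} → K ∈ R₀ → Separated S K
      S-separated K∈R₀ = All.lookup (AllPairs.head separated) K∈R₀

      v∉ : ∀ {K} → K ∈ R₀ → ¬ InSpan T K v
      v∉ K∈R₀ = proj₁ (S-separated K∈R₀) v (proj₂ (Crossing⇒EdgeInSpan crossing))

      S⊆B : S ⊆ B
      S⊆B = Crossing⇒⊆B (proj₁ (proj₂ (All.head valid))) crossing

      block-of : ∀ {a} → a ∈ A → ∃ λ K → K ∈ R₀ × K ⊆ A × a ∈ K
      block-of a∈A with ∈-concat⁻′ (S ∷ R₀) (∈-resp-↭ (↭-sym blocks↭L) (A⊆L a∈A))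
      ... | K , a∈K , here refl = ⊥-elim (A∩B=∅ a∈A (S⊆B a∈K))
      ... | K , a∈K , there K∈R₀ =
        K , K∈R₀ , Refines-A (proj₁ (proj₂ (All.lookup (All.tail valid) K∈R₀))) a∈K a∈A , a∈K

      closest-lower : ∃ λ K → K ∈ R₀ × Closest Lower R₀ K
      closest-lower with block-of a₁.taxon∈
      ... | K , K∈R₀ , K⊆A , a₁∈K =
        closest-exists {Lower} Lower? R₀ (K , K∈R₀ , K⊆A , lose a₁∈K (a₁.pos , a₁.leafAt , a₁.holds))

      closest-upper : ∃ λ K → K ∈ R₀ × Closest (∁ Lower) R₀ K
      closest-upper with block-of a₂.taxon∈
      ... | K , K∈R₀ , K⊆A , a₂∈K =
        closest-exists {∁ Lower} (∁? Lower?) R₀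
          (K , K∈R₀ , K⊆A , lose a₂∈K (λ lower → a₂.holds (Lower⇒v⊑ lower a₂.leafAt)))

      lower≢upper : ∀ {K₁ K₂} → K₁ ∈ R₀ → Closest Lower R₀ K₁ → Closest (∁ Lower) R₀ K₂ → K₁ ≢ K₂
      lower≢upper K₁∈R₀ c₁ c₂ refl with find (Closest.witness c₁) | find (Closest.witness c₂)
      ... | x , x∈K , lower-x | y , y∈K , upper-y with ∈⇒LeafAt {T} (A⊆L (Closest.⊆A c₂ y∈K))
      ...   | qy , ly = upper-y (qy , ly , span∌v⇒lower-closed (v∉ K₁∈R₀) x∈K lower-x y∈K ly)

    closest-pair : ∃ λ K₁ → ∃ λ K₂ → ∃ λ R →
      R₀ ↭ K₁ ∷ K₂ ∷ R × Closest Lower R K₁ × Closest (∁ Lower) R K₂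
    closest-pair = pair closest-lower closest-upper
      where
      pair : (∃ λ K → K ∈ R₀ × Closest Lower R₀ K) → (∃ λ K → K ∈ R₀ × Closest (∁ Lower) R₀ K) →
        ∃ λ K₁ → ∃ λ K₂ → ∃ λ R → R₀ ↭ K₁ ∷ K₂ ∷ R × Closest Lower R K₁ × Closest (∁ Lower) R K₂
      pair (K₁ , K₁∈R₀ , c₁) (K₂ , K₂∈R₀ , c₂) with ∈⇒↭∷ K₁∈R₀
      ... | R₁ , R₀↭K₁R₁ with ∈-resp-↭ R₀↭K₁R₁ K₂∈R₀
      ...   | here K₂≡K₁ = ⊥-elim (lower≢upper K₁∈R₀ c₁ c₂ (sym K₂≡K₁))
      ...   | there K₂∈R₁ with ∈⇒↭∷ K₂∈R₁
      ...     | R , R₁↭K₂R = K₁ , K₂ , R , R₀↭K₁K₂R , Closest-⊆ R⊆R₀ c₁ , Closest-⊆ R⊆R₀ c₂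
        where
        R₀↭K₁K₂R : R₀ ↭ K₁ ∷ K₂ ∷ R
        R₀↭K₁K₂R = ↭-trans R₀↭K₁R₁ (prep K₁ R₁↭K₂R)
        R⊆R₀ : R ⊆ R₀
        R⊆R₀ K∈R = ∈-resp-↭ (↭-sym R₀↭K₁K₂R) (there (there K∈R))

  ValidBlock-A : ∀ {X x} → X ⊆ A → x ∈ X → ValidBlock X
  ValidBlock-A {X} X⊆A x∈X = (λ { refl → case x∈X of λ () }) , inj₁ X⊆A , agrees
    where
    agrees : Agrees X
    agrees D c X⊆D with component-A c (X⊆D x∈X) (X⊆A x∈X)
    ... | refl = restrict-agree-⊆ {t = T} {tA} X⊆A agree-A

  SpanDisjoint⇒Separated-A : ∀ {X Y x} → X ⊆ A → x ∈ X → SpanDisjoint T X Y → Separated X Y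
  SpanDisjoint⇒Separated-A {X} {Y} X⊆A x∈X disjT = disjT , inF
    where
    inF : DisjointInForest X Y
    inF D c X⊆D Y⊆D with component-A c (X⊆D x∈X) (X⊆A x∈X)
    ... | refl = SpanDisjoint-transfer {T} {tA} X⊆A Y⊆D agree-A disjT

  SpanDisjoint⇒Separated-BA : ∀ {X Y x y} → X ⊆ B → x ∈ X → Y ⊆ A → y ∈ Y →
    SpanDisjoint T X Y → Separated X Y
  SpanDisjoint⇒Separated-BA {X} {Y} X⊆B x∈X Y⊆A y∈Y disjT = disjT , inF
    where
    inF : DisjointInForest X Y
    inF D c X⊆D Y⊆D with component-B c (X⊆D x∈X) (X⊆B x∈X)
    ... | refl = ⊥-elim (A∩B=∅ (Y⊆A y∈Y) (Y⊆D y∈Y))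

  filter-∁-↭ : ∀ {P : ℕ → Set} (P? : Decidable P) xs → (filter P? xs ++ filter (∁? P?) xs) ↭ xs
  filter-∁-↭ P? xs = ↭-sym (subst (λ (ys , zs) → xs ↭ ys ++ zs) (partition-defn P? xs)
    (↭ₛ⇒↭ (Permutationₛ.partition-↭ (setoid ℕ) P? xs)))

  module Merge {S K₁ K₂ R} (af : AgreementForest (S ∷ K₁ ∷ K₂ ∷ R)) (crossing : Crossing S)
    (c₁ : Closest Lower R K₁) (c₂ : Closest (∁ Lower) R K₂) where

    private
      open AgreementForest af renaming (partition to blocks↭L)
      module c₁ = Closest c₁
      module c₂ = Closest c₂

      validS : ValidBlock S
      validS = All.head valid

      separated-S : All (Separated S) (K₁ ∷ K₂ ∷ R)
      separated-S = AllPairs.head separated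

      separated-K₁ : All (Separated K₁) R
      separated-K₁ = All.tail (AllPairs.head (AllPairs.tail separated))

      separated-K₂ : All (Separated K₂) R
      separated-K₂ = AllPairs.head (AllPairs.tail (AllPairs.tail separated))

      separated-S-R : All (Separated S) R
      separated-S-R = All.tail (All.tail separated-S)

      validR : All ValidBlock R
      validR = All.tail (All.tail (All.tail valid))

      S⊆B : S ⊆ B
      S⊆B = Crossing⇒⊆B (proj₁ (proj₂ validS)) crossing

      ∉S-span : ∀ {K r} → Separated S K → InSpan T S r → ¬ InSpan T K r
      ∉S-span sep r∈S = proj₁ sep _ r∈S

      e∈S : EdgeInSpan T S (u , b)
      e∈S = Crossing⇒EdgeInSpan crossing

      K₁-lower : ∀ {y q} → y ∈ K₁ → LeafAt T q y → v ⊑ q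
      K₁-lower with find c₁.witness
      ... | x , x∈K₁ , lower-x = span∌v⇒lower-closed (∉S-span (All.head separated-S) (proj₂ e∈S)) x∈K₁ lower-x

      K₂-upper : ∀ {y q} → y ∈ K₂ → LeafAt T q y → ¬ v ⊑ q
      K₂-upper y∈K₂ ly v⊑q with find c₂.witness
      ... | x , x∈K₂ , upper-x with ∈⇒LeafAt {T} (A⊆L (c₂.⊆A x∈K₂))
      ...   | qx , lx = upper-x (qx , lx , span∌v⇒lower-closed
                          (∉S-span (All.head (All.tail separated-S)) (proj₂ e∈S)) y∈K₂ (_ , ly , v⊑q) x∈K₂ lx)

      u∉R : ∀ {K} → K ∈ R → ¬ InSpan T K u
      u∉R K∈R = ∉S-span (All.lookup separated-S-R K∈R) (proj₁ e∈S)

      v∉R : ∀ {K} → K ∈ R → ¬ InSpan T K v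
      v∉R K∈R = ∉S-span (All.lookup separated-S-R K∈R) (proj₂ e∈S)

      -- Between u and the vertex chosen in a closest block, T meets no other block of R:
      -- such a vertex would lie in T[A], hence in an A-block closer to u.
      path-free : ∀ {Side Kᵢ} (c : Closest Side R Kᵢ) → All (Separated Kᵢ) R →
        (∀ {K r} → K ⊆ A → InSpan T K r → OnPath u (Closest.vertex c) r → r ≢ u → Any Side K) →
        ∀ {K r} → K ∈ R → InSpan T K r → OnPath u (Closest.vertex c) r → ⊥
      path-free c separated-Kᵢ side {K} {r} K∈R r∈K o with r ≟ₚ u | r ≟ₚ Closest.vertex c
      ... | yes refl | _ = u∉R K∈R r∈K
      ... | no _ | yes refl = proj₁ (All.lookup separated-Kᵢ K∈R) r (Closest.vertex∈ c) r∈K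
      ... | no r≢u | no r≢h = by-refines (proj₁ (proj₂ (All.lookup validR K∈R)))
        where
        r∈A : InSpan T A r
        r∈A = InSpan-convex (proj₁ e∈A) (InSpan-mono (Closest.⊆A c) (Closest.vertex∈ c)) o
        by-refines : Refines K → ⊥
        by-refines (inj₁ K⊆A) =
          <⇒≱ (OnPath⇒offsetDist< o r≢h) (Closest.closest c K∈R K⊆A (side K⊆A r∈K o r≢u) r∈K)
        by-refines (inj₂ (inj₁ K⊆B)) with InSpan-A∩B r∈A (InSpan-mono K⊆B r∈K)
        ... | inj₁ r≡u = r≢u r≡u
        ... | inj₂ refl = v∉R K∈R r∈K
        by-refines (inj₂ (inj₂ K⊆C)) = C#A r (InSpan-mono K⊆C r∈K) r∈A

      lower-side : ∀ {K r} → K ⊆ A → InSpan T K r → OnPath u c₁.vertex r → r ≢ u → Any Lower K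
      lower-side K⊆A r∈K o r≢u with InSpan⇒Above r∈K
      ... | x , q , x∈K , lx , r⊑q =
        lose x∈K (q , lx , ⊑-trans (OnPath-below-step (InSpan-below K₁-lower c₁.vertex∈) o r≢u) r⊑q)

      upper-side : ∀ {K r} → K ⊆ A → InSpan T K r → OnPath u c₂.vertex r → r ≢ u → Any (∁ Lower) K
      upper-side {K} {r} K⊆A r∈K (r⊑u⊎r⊑h , _) _ with any? (∁? Lower?) K
      ... | yes upper = upper
      ... | no ¬upper = ⊥-elim (v⋢r r⊑u⊎r⊑h)
        where
        v⊑r : v ⊑ r
        v⊑r = InSpan-below (λ y∈K ly → Lower⇒v⊑ (decidable-stable (Lower? _) (¬upper ∘ lose y∈K)) ly) r∈K
        v⋢r : r ⊑ u ⊎ r ⊑ c₂.vertex → ⊥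
        v⋢r (inj₁ r⊑u) = step⋢ (⊑-trans v⊑r r⊑u)
        v⋢r (inj₂ r⊑h) with InSpan⇒Above c₂.vertex∈
        ... | y , q , y∈K₂ , ly , h⊑q = K₂-upper y∈K₂ ly (⊑-trans v⊑r (⊑-trans r⊑h h⊑q))

    S₁ S₂ M : List ℕ
    S₁ = filter Lower? S
    S₂ = filter (∁? Lower?) S
    M = K₁ ++ K₂

    private
      S₁⊆S : S₁ ⊆ S
      S₁⊆S x∈ = proj₁ (∈-filter⁻ Lower? {xs = S} x∈)

      S₂⊆S : S₂ ⊆ S
      S₂⊆S x∈ = proj₁ (∈-filter⁻ (∁? Lower?) {xs = S} x∈)

      S₁-lower : ∀ {x} → x ∈ S₁ → Lower x
      S₁-lower x∈ = proj₂ (∈-filter⁻ Lower? {xs = S} x∈)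

      S₂-upper : ∀ {x} → x ∈ S₂ → ¬ Lower x
      S₂-upper x∈ = proj₂ (∈-filter⁻ (∁? Lower?) {xs = S} x∈)

      S₁-inhabited : ∃ λ x → x ∈ S₁
      S₁-inhabited = let (x , _ , x∈S , _ , _ , lower-x , _) = crossing in x , ∈-filter⁺ Lower? x∈S lower-x

      S₂-inhabited : ∃ λ y → y ∈ S₂
      S₂-inhabited =
        let (_ , y , _ , y∈S , _ , _ , _ , upper-y) = crossing in y , ∈-filter⁺ (∁? Lower?) y∈S upper-y

      M-inhabited : ∃ λ x → x ∈ M
      M-inhabited = let (x , x∈K₁ , _) = find c₁.witness in x , ∈-++⁺ˡ x∈K₁

      M⊆A : M ⊆ A
      M⊆A x∈M with ∈-++⁻ K₁ x∈M
      ... | inj₁ x∈K₁ = c₁.⊆A x∈K₁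
      ... | inj₂ x∈K₂ = c₂.⊆A x∈K₂

      S₁-below-v : ∀ {r} → InSpan T S₁ r → v ⊑ r
      S₁-below-v = InSpan-below (λ x∈ lx → Lower⇒v⊑ (S₁-lower x∈) lx)

      S₂-not-below-v : ∀ {r} → InSpan T S₂ r → ¬ v ⊑ r
      S₂-not-below-v r∈ v⊑r with InSpan⇒Above r∈
      ... | x , q , x∈ , lx , r⊑q = S₂-upper x∈ (q , lx , ⊑-trans v⊑r r⊑q)

      u,v∉S₁ : ∀ {r} → InSpan T S₁ r → r ≡ u ⊎ r ≡ v → ⊥
      u,v∉S₁ r∈ (inj₁ refl) = step⋢ (S₁-below-v r∈)
      u,v∉S₁ r∈ (inj₂ refl) = InSpan-lower⇒v∉ (λ x∈ → S⊆B (S₁⊆S x∈)) S₁-lower r∈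

      u,v∉S₂ : ∀ {r} → InSpan T S₂ r → r ≡ u ⊎ r ≡ v → ⊥
      u,v∉S₂ r∈ (inj₁ refl) = InSpan-upper⇒u∉ (λ x∈ → S⊆B (S₂⊆S x∈)) S₂-upper r∈
      u,v∉S₂ r∈ (inj₂ refl) = S₂-not-below-v r∈ ⊑-refl

      SpanDisjoint-M : ∀ {X} → X ⊆ B → (∀ {r} → InSpan T X r → r ≡ u ⊎ r ≡ v → ⊥) → SpanDisjoint T X M
      SpanDisjoint-M X⊆B u,v∉X r r∈X r∈M = u,v∉X r∈X (InSpan-A∩B (InSpan-mono M⊆A r∈M) (InSpan-mono X⊆B r∈X))

      -- T[M] consists of T[K₁], T[K₂] and the path between them, which runs through u.
      SpanDisjoint-M-R : ∀ {K} → K ∈ R → SpanDisjoint T M K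
      SpanDisjoint-M-R K∈R r r∈M r∈K with InSpan-++ c₁.vertex∈ c₂.vertex∈ r∈M
      ... | inj₁ r∈K₁ = proj₁ (All.lookup separated-K₁ K∈R) r r∈K₁ r∈K
      ... | inj₂ (inj₁ r∈K₂) = proj₁ (All.lookup separated-K₂ K∈R) r r∈K₂ r∈K
      ... | inj₂ (inj₂ o) with OnPath-via u o
      ...   | inj₁ o₁ = path-free c₁ separated-K₁ lower-side K∈R r∈K (OnPath-sym o₁)
      ...   | inj₂ o₂ = path-free c₂ separated-K₂ upper-side K∈R r∈K o₂

      refinesS : Refines S
      refinesS = proj₁ (proj₂ validS)

      agreesS : Agrees S
      agreesS = proj₂ (proj₂ validS)

      S₁-S₂ : SpanDisjoint T S₁ S₂
      S₁-S₂ r r∈S₁ r∈S₂ = S₂-not-below-v r∈S₂ (S₁-below-v r∈S₁)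

      blocks↭L′ : concat (S₁ ∷ S₂ ∷ M ∷ R) ↭ leaves T
      blocks↭L′ = begin
        S₁ ++ S₂ ++ M ++ concat R     ≡⟨ ++-assoc S₁ S₂ (M ++ concat R) ⟨
        (S₁ ++ S₂) ++ M ++ concat R   ↭⟨ ++⁺ʳ (M ++ concat R) (filter-∁-↭ Lower? S) ⟩
        S ++ (K₁ ++ K₂) ++ concat R   ≡⟨ cong (S ++_) (++-assoc K₁ K₂ (concat R)) ⟩
        S ++ K₁ ++ K₂ ++ concat R     ↭⟨ blocks↭L ⟩
        leaves T                      ∎
        where open PermutationReasoning

    merged : AgreementForest (S₁ ∷ S₂ ∷ M ∷ R)
    merged = mkAF
      (ValidBlock-⊆ S₁⊆S (proj₂ S₁-inhabited) refinesS agreesS ∷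
       ValidBlock-⊆ S₂⊆S (proj₂ S₂-inhabited) refinesS agreesS ∷
       ValidBlock-A M⊆A (proj₂ M-inhabited) ∷
       validR)
      blocks↭L′
      ((Separated-within S₁⊆S (proj₂ S₁-inhabited) refinesS S₂⊆S agreesS S₁-S₂ ∷
        SpanDisjoint⇒Separated-BA (λ x∈ → S⊆B (S₁⊆S x∈)) (proj₂ S₁-inhabited) M⊆A (proj₂ M-inhabited)
          (SpanDisjoint-M (λ x∈ → S⊆B (S₁⊆S x∈)) u,v∉S₁) ∷
        All.map (Separated-⊆ S₁⊆S (proj₂ S₁-inhabited) refinesS) separated-S-R) ∷
       (SpanDisjoint⇒Separated-BA (λ x∈ → S⊆B (S₂⊆S x∈)) (proj₂ S₂-inhabited) M⊆A (proj₂ M-inhabited)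
          (SpanDisjoint-M (λ x∈ → S⊆B (S₂⊆S x∈)) u,v∉S₂) ∷
        All.map (Separated-⊆ S₂⊆S (proj₂ S₂-inhabited) refinesS) separated-S-R) ∷
       All.tabulate (λ K∈R → SpanDisjoint⇒Separated-A M⊆A (proj₂ M-inhabited) (SpanDisjoint-M-R K∈R)) ∷
       AllPairs.tail (AllPairs.tail (AllPairs.tail separated)))

    crossing-free : All (¬_ ∘ Crossing) (S₁ ∷ S₂ ∷ M ∷ R)
    crossing-free =
      (λ (_ , _ , _ , y∈S₁ , _ , _ , _ , upper-y) → upper-y (S₁-lower y∈S₁)) ∷
      (λ (_ , _ , x∈S₂ , _ , _ , lower-x , _) → S₂-upper x∈S₂ lower-x) ∷
      (λ (_ , _ , x∈M , _ , x∈B , _) → A∩B=∅ (M⊆A x∈M) x∈B) ∷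
      All.tabulate (λ K∈R crossing-K → v∉R K∈R (proj₂ (Crossing⇒EdgeInSpan crossing-K)))

  CrossingFreeForest : ℕ → Set
  CrossingFreeForest n = ∃ λ P → AgreementForest P × length P ≡ n × All (¬_ ∘ Crossing) P

  uncross : ∀ {S R₀} → AgreementForest (S ∷ R₀) → Crossing S → CrossingFreeForest (length (S ∷ R₀))
  uncross {S} {R₀} af crossing = merge (closest-pair af crossing)
    where
    merge : (∃ λ K₁ → ∃ λ K₂ → ∃ λ R → R₀ ↭ K₁ ∷ K₂ ∷ R × Closest Lower R K₁ × Closest (∁ Lower) R K₂) →
      CrossingFreeForest (length (S ∷ R₀))
    merge (K₁ , K₂ , R , R₀↭K₁K₂R , c₁ , c₂) =
      S₁ ∷ S₂ ∷ M ∷ R , merged , sym (↭-length (prep S R₀↭K₁K₂R)) , crossing-free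
      where open Merge (AgreementForest-resp-↭ (prep S R₀↭K₁K₂R) af) crossing c₁ c₂

  crossing-free-forest : ∀ {P₀} → AgreementForest P₀ → CrossingFreeForest (length P₀)
  crossing-free-forest {P₀} af with any? Crossing? P₀
  ... | no ¬crossing = P₀ , af , refl , ¬Any⇒All¬ P₀ ¬crossing
  ... | yes some = from-crossing (find {P = Crossing} some)
    where
    from-crossing : (∃ λ S → S ∈ P₀ × Crossing S) → CrossingFreeForest (length P₀)
    from-crossing (S , S∈P₀ , crossing) =
      let (R₀ , P₀↭SR₀) = ∈⇒↭∷ S∈P₀
          (P , af′ , length≡ , crossing-free) = uncross (AgreementForest-resp-↭ P₀↭SR₀ af) crossing
      in P , af′ , trans length≡ (sym (↭-length P₀↭SR₀)) , crossing-free

lemma13 : (T tA tB tC : Tree) →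
    Phylo T → Phylo tA → Phylo tB → Phylo tC →
    (leaves tA ++ leaves tB ++ leaves tC) ↭ leaves T →
    restrict (leaves tA) T ≃ restrict (leaves tA) tA →
    restrict (leaves tC) T ≃ restrict (leaves tC) tC →
    ¬ (restrict (leaves tB) T ≃ restrict (leaves tB) tB) →
    SpanDisjoint T (leaves tC) (leaves tA) →
    SpanDisjoint T (leaves tC) (leaves tB) →
    (e : Edge) →
    EdgeInSpan T (leaves tA) e → EdgeInSpan T (leaves tB) e →
    (∀ e′ → EdgeInSpan T (leaves tA) e′ → EdgeInSpan T (leaves tB) e′ → e′ ≡ e) →
    ∃ λ P → MinReachableAF T tA tB tC P ×
      All (λ S → ¬ (∃ λ x → ∃ λ y → x ∈ S × y ∈ S ×
                      x ∈ leaves tB × Below T e x ×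
                      y ∈ leaves tB × ¬ Below T e y)) P
lemma13 T tA tB tC phT phA phB phC partition agree-A _ _ C#A _ (u , b) e∈A e∈B e-unique =
  let (P₀ , af₀ , minimal) = MinimumForest.minimum-exists T tA tB tC phT phA phB phC partition
      (P , af , length≡ , crossing-free) =
        Exchange.crossing-free-forest T tA tB tC phT partition agree-A C#A u b e∈A e∈B e-unique af₀
  in P ,
     (Forests.AgreementForest⇒Reachable T tA tB tC af ,
      λ Q reachable → subst (_≤ length Q) (sym length≡) (minimal Q reachable)) ,
     crossing-free
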